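{- For every $n\ge 1$, the set $\mathrm{Schr}_n(\mathsf{U}\mathsf{U}\mathsf{D}\mathsf{D})$ is in bijection with $\mathscr{G}_{n+1}(35124)$.
   Context: A permutation is Grassmannian if it has at most one descent (a position $i$ with $\pi(i)>\pi(i+1)$); $\mathscr{G}_{n+1}(35124)$ is the set of Grassmannian permutations of $[n+1]$ avoiding the classical pattern $35124$. Consider words over $\{\mathsf{U},\mathsf{D},\mathsf{H}\}$ with $\mathrm{val}(\mathsf{U})=1$, $\mathrm{val}(\mathsf{D})=-1$, $\mathrm{val}(\mathsf{H})=0$, extended additively to words. A Schröder word of semilength $n$ is such a word $w$ with $\mathrm{val}(w)=0$, $\mathrm{val}(u)\ge 0$ for every prefix $u$ of $w$, and $\#\mathsf{U}+\#\mathsf{D}+2\,\#\mathsf{H}=2n$ (it encodes a Schröder path from $(0,0)$ to $(2n,0)$ with steps $(1,1)$, $(1,-1)$, $(2,0)$). $\mathrm{Schr}_n(\mathsf{U}\mathsf{U}\mathsf{D}\mathsf{D})$ is the set of Schröder words $w$ of semilength $n$ such that every prefix $u$ of $w$ has $\mathrm{val}(u)\in\{0,1\}$ and $w$ contains at most two letters $\mathsf{U}$. -}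

module Defs where

open import Data.Nat as ℕ using (ℕ; zero; suc; _+_; _*_)
open import Data.Integer as ℤ using (ℤ; 0ℤ; 1ℤ)
import Data.Integer.Properties as ℤP
import Data.Nat.Properties as ℕP
open import Data.Fin using (Fin; inject₁) renaming (suc to fsuc)
open import Data.Fin.Properties using (any?; all?) renaming (_≟_ to _≟ᶠ_)
import Data.Fin as F
open import Data.Vec using (Vec; lookup)
open import Data.List using (List; []; _∷_; inits)
open import Data.List.Relation.Unary.All using (All)
import Data.List.Relation.Unary.All as All
open import Data.Product using (Σ; ∃; _×_; _,_)
open import Data.Sum using (_⊎_)
open import Relation.Nullary.Negation using (¬_)
open import Relation.Binary.PropositionalEquality using (_≡_)
open import Relation.Nullary.Decidable using (Dec; True; ¬?; _×-dec_; _⊎-dec_; _→-dec_)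

-- Permutations of [m] in one-line notation: π = (π(1) … π(m)) is a
-- vector of length m with entries in Fin m (value k stands for k+1),
-- and π is a bijection, i.e. injective (equivalent for finite sets).

IsPerm : {m : ℕ} → Vec (Fin m) m → Set
IsPerm {m} π = (i j : Fin m) → lookup π i ≡ lookup π j → i ≡ j

-- A descent of π ∈ S_{k+1} is a position i (1 ≤ i ≤ k), here i : Fin k,
-- with π(i) > π(i+1).
Descent : {k : ℕ} → Vec (Fin (suc k)) (suc k) → Fin k → Set
Descent π i = lookup π (fsuc i) F.< lookup π (inject₁ i)

IsGrassmannian : {k : ℕ} → Vec (Fin (suc k)) (suc k) → Set
IsGrassmannian {k} π = (i j : Fin k) → Descent π i → Descent π j → i ≡ j

Contains35124 : {m : ℕ} → Vec (Fin m) m → Set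
Contains35124 {m} π =
  ∃ λ (i₁ : Fin m) → ∃ λ (i₂ : Fin m) → ∃ λ (i₃ : Fin m) →
  ∃ λ (i₄ : Fin m) → ∃ λ (i₅ : Fin m) →
    (i₁ F.< i₂ × i₂ F.< i₃ × i₃ F.< i₄ × i₄ F.< i₅) ×
    (lookup π i₃ F.< lookup π i₄ × lookup π i₄ F.< lookup π i₁ ×
     lookup π i₁ F.< lookup π i₅ × lookup π i₅ F.< lookup π i₂)

Avoids35124 : {m : ℕ} → Vec (Fin m) m → Set
Avoids35124 π = ¬ Contains35124 π

-- decidability (used only to carve out subsets with proof-irrelevant
-- membership witnesses `True (…)`)
isPerm? : {m : ℕ} (π : Vec (Fin m) m) → Dec (IsPerm π)
isPerm? π = all? λ i → all? λ j → (lookup π i ≟ᶠ lookup π j) →-dec (i ≟ᶠ j)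

descent? : {k : ℕ} (π : Vec (Fin (suc k)) (suc k)) (i : Fin k) → Dec (Descent π i)
descent? π i = lookup π (fsuc i) F.<? lookup π (inject₁ i)

isGrassmannian? : {k : ℕ} (π : Vec (Fin (suc k)) (suc k)) → Dec (IsGrassmannian π)
isGrassmannian? π = all? λ i → all? λ j →
  descent? π i →-dec (descent? π j →-dec (i ≟ᶠ j))

contains35124? : {m : ℕ} (π : Vec (Fin m) m) → Dec (Contains35124 π)
contains35124? π =
  any? λ i₁ → any? λ i₂ → any? λ i₃ → any? λ i₄ → any? λ i₅ →
    ((i₁ F.<? i₂) ×-dec (i₂ F.<? i₃) ×-dec (i₃ F.<? i₄) ×-dec (i₄ F.<? i₅)) ×-dec
    ((lookup π i₃ F.<? lookup π i₄) ×-dec (lookup π i₄ F.<? lookup π i₁) ×-dec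
     (lookup π i₁ F.<? lookup π i₅) ×-dec (lookup π i₅ F.<? lookup π i₂))

avoids35124? : {m : ℕ} (π : Vec (Fin m) m) → Dec (Avoids35124 π)
avoids35124? π = ¬? (contains35124? π)

IsGrassAvoid : {k : ℕ} → Vec (Fin (suc k)) (suc k) → Set
IsGrassAvoid π = IsPerm π × IsGrassmannian π × Avoids35124 π

isGrassAvoid? : {k : ℕ} (π : Vec (Fin (suc k)) (suc k)) → Dec (IsGrassAvoid π)
isGrassAvoid? π = isPerm? π ×-dec isGrassmannian? π ×-dec avoids35124? π

G35124 : ℕ → Set
G35124 k = Σ (Vec (Fin (suc k)) (suc k)) λ π → True (isGrassAvoid? π)

data Letter : Set where
  U D H : Letter

valL : Letter → ℤ
valL U = 1ℤ
valL D = ℤ.- 1ℤ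
valL H = 0ℤ

val : List Letter → ℤ
val []      = 0ℤ
val (a ∷ w) = valL a ℤ.+ val w

occ : Letter → List Letter → ℕ
occ a [] = 0
occ U (U ∷ w) = suc (occ U w)
occ D (D ∷ w) = suc (occ D w)
occ H (H ∷ w) = suc (occ H w)
occ a (_ ∷ w) = occ a w

IsSchroder : ℕ → List Letter → Set
IsSchroder n w =
  val w ≡ 0ℤ × All (λ u → 0ℤ ℤ.≤ val u) (inits w) ×
  occ U w + occ D w + 2 * occ H w ≡ 2 * n

IsRestricted : List Letter → Set
IsRestricted w = All (λ u → val u ≡ 0ℤ ⊎ val u ≡ 1ℤ) (inits w) × occ U w ℕ.≤ 2

IsSchrUUDD : ℕ → List Letter → Set
IsSchrUUDD n w = IsSchroder n w × IsRestricted w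

isSchrUUDD? : (n : ℕ) (w : List Letter) → Dec (IsSchrUUDD n w)
isSchrUUDD? n w =
  ((val w ℤP.≟ 0ℤ) ×-dec All.all? (λ u → 0ℤ ℤP.≤? val u) (inits w) ×-dec
   (occ U w + occ D w + 2 * occ H w ℕP.≟ 2 * n)) ×-dec
  (All.all? (λ u → (val u ℤP.≟ 0ℤ) ⊎-dec (val u ℤP.≟ 1ℤ)) (inits w) ×-dec
   (occ U w ℕP.≤? 2))

SchrUUDD : ℕ → Set
SchrUUDD n = Σ (List Letter) λ w → True (isSchrUUDD? n w)

module Submission where

-- Both sets are in bijection with the shapes H^n, H^a U H^b D H^c and H^a U H^b D H^c U H^d D H^e
-- of the words in Schr_n(UUDD); on the word side this is a parse of a path staying at heights
-- 0 and 1. A Grassmannian permutation p with descent at k increases on [0, k] and on [k + 1, n], so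
-- it is determined by its first run. With a = p (k + 1), the values below a start that run. If
-- p k = k + 1 the run is [0, k + 1] without a; otherwise it leaves a gap and ends with a block of
-- consecutive values, consecutive because a skipped value would create a 35124. The two resulting
-- families of permutations are parametrised exactly like the words.

open import Data.Bool using (if_then_else_)
open import Data.Bool.Properties using (T-irrelevant)
open import Data.Empty using (⊥; ⊥-elim)
open import Data.Fin as F using (Fin; toℕ; fromℕ<; inject₁) renaming (suc to fsuc)
import Data.Fin.Properties as FP
open import Data.Integer as ℤ using (ℤ; 0ℤ; 1ℤ; +≤+)
import Data.Integer.Properties as ℤP
open import Data.List using (List; []; _∷_; _++_; replicate; inits)
open import Data.List.Properties using (∷-injective)
open import Data.List.Relation.Unary.All as All using (All; []; _∷_)
import Data.List.Relation.Unary.All.Properties as AllP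
open import Data.Nat using (ℕ; zero; suc; _+_; _*_; _∸_; _≤_; _<_; z≤n; s≤s; _<?_; _≤?_; _≟_)
open import Data.Nat.Induction using (<-rec)
open import Data.Nat.Properties
open import Data.Nat.Tactic.RingSolver using (solve-∀)
open import Data.Product using (Σ; ∃; _×_; _,_; proj₁; proj₂; map₁)
open import Data.Sum using (_⊎_; inj₁; inj₂)
open import Data.Vec using (Vec; lookup; tabulate)
open import Data.Vec.Properties using (lookup∘tabulate; tabulate∘lookup; tabulate-cong)
open import Function.Bundles using (_↔_; mk↔ₛ′)
open import Function.Definitions using (Injective)
open import Function.Properties.Inverse using (↔-sym; ↔-trans)
open import Relation.Binary using (tri<; tri≈; tri>)
open import Relation.Binary.PropositionalEquality
open import Relation.Nullary using (¬_; Dec; yes; no; does)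
open import Relation.Nullary.Decidable using (True; toWitness; fromWitness; dec-true; dec-false)

open import Defs

module _ {S A : Set} {P : A → Set} (P? : ∀ x → Dec (P x)) (encode : S → A) (encode-P : ∀ s → P (encode s))
         (decode : ∀ x → P x → Σ S λ s → encode s ≡ x)
         (encode-injective : ∀ s s' → encode s ≡ encode s' → s ≡ s') where

  ↔-subset : S ↔ Σ A (λ x → True (P? x))
  ↔-subset = mk↔ₛ′ to from to∘from from∘to
    where
    to : S → Σ A (λ x → True (P? x))
    to s = encode s , fromWitness (encode-P s)
    decoded : ∀ (x : Σ A (λ x → True (P? x))) → Σ S λ s → encode s ≡ proj₁ x
    decoded (x , t) = decode x (toWitness t)
    from : Σ A (λ x → True (P? x)) → S
    from x = proj₁ (decoded x)
    to∘from : ∀ x → to (from x) ≡ x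
    to∘from (x , t) with decoded (x , t)
    ... | s , refl = cong (encode s ,_) (T-irrelevant _ t)
    from∘to : ∀ s → from (to s) ≡ s
    from∘to s = encode-injective _ s (proj₂ (decoded (to s)))

IncreasingOn : (ℕ → ℕ) → ℕ → ℕ → Set
IncreasingOn p lo hi = ∀ i → lo ≤ i → suc i < hi → p i < p (suc i)

module _ {p : ℕ → ℕ} {lo hi : ℕ} (inc : IncreasingOn p lo hi) where

  increasing⇒gap : ∀ {i j} → lo ≤ i → i ≤ j → j < hi → (j ∸ i) + p i ≤ p j
  increasing⇒gap {i} {j} lo≤i i≤j j<hi =
    subst (λ x → (j ∸ i) + p i ≤ p x) (m∸n+n≡m i≤j)
      (gap (j ∸ i) (subst (_< hi) (sym (m∸n+n≡m i≤j)) j<hi))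
    where
    gap : ∀ t → t + i < hi → t + p i ≤ p (t + i)
    gap zero    _ = ≤-refl
    gap (suc t) h = ≤-trans (s≤s (gap t (<-trans (n<1+n _) h))) (inc (t + i) (≤-trans lo≤i (m≤n+m i t)) h)

  increasing⇒< : ∀ {i j} → lo ≤ i → i < j → j < hi → p i < p j
  increasing⇒< {i} lo≤i i<j j<hi =
    ≤-trans (+-monoˡ-≤ (p i) (m<n⇒0<n∸m i<j)) (increasing⇒gap lo≤i (<⇒≤ i<j) j<hi)

  increasing⇒≤ : ∀ {i j} → lo ≤ i → i ≤ j → j < hi → p i ≤ p j
  increasing⇒≤ {i} lo≤i i≤j j<hi = ≤-trans (m≤n+m (p i) _) (increasing⇒gap lo≤i i≤j j<hi)

  increasing⇒≤-shift : ∀ {i j} c → lo ≤ i → i ≤ j → j < hi → p j ≤ c + j → p i ≤ c + i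
  increasing⇒≤-shift {i} {j} c lo≤i i≤j j<hi pj≤ =
    +-cancelˡ-≤ (j ∸ i) (p i) (c + i)
      (≤-trans (increasing⇒gap lo≤i i≤j j<hi) (subst (p j ≤_) c+j≡ pj≤))
    where
    c+j≡ : c + j ≡ (j ∸ i) + (c + i)
    c+j≡ = trans (cong (c +_) (sym (m∸n+n≡m i≤j))) (swap c (j ∸ i) i)
      where
      swap : ∀ c x i → c + (x + i) ≡ x + (c + i)
      swap = solve-∀

injective⇒surjective : ∀ {m} (f : Fin m → Fin m) → Injective _≡_ _≡_ f → ∀ v → ∃ λ i → f i ≡ v
injective⇒surjective {zero}  f inj ()
injective⇒surjective {suc m} f inj v with FP.any? (λ i → f i FP.≟ v)
... | yes hit = hit
... | no miss = ⊥-elim (1+n≰n (FP.injective⇒≤ {f = squeeze} squeeze-injective))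
  where
  f≢v : ∀ i → v ≢ f i
  f≢v i e = miss (i , sym e)
  squeeze : Fin (suc m) → Fin m
  squeeze i = F.punchOut (f≢v i)
  squeeze-injective : Injective _≡_ _≡_ squeeze
  squeeze-injective {i} {j} e = inj (FP.punchOut-injective (f≢v i) (f≢v j) e)

record IsPermOn (m : ℕ) (p : ℕ → ℕ) : Set where
  field
    bounded   : ∀ {i} → i < m → p i < m
    injective : ∀ {i j} → i < m → j < m → p i ≡ p j → i ≡ j

  private
    restrict : Fin m → Fin m
    restrict j = fromℕ< (bounded (FP.toℕ<n j))

    restrict-injective : Injective _≡_ _≡_ restrict
    restrict-injective e = FP.toℕ-injective (injective (FP.toℕ<n _) (FP.toℕ<n _)
      (trans (sym (FP.toℕ-fromℕ< _)) (trans (cong toℕ e) (FP.toℕ-fromℕ< _))))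

  surjective : ∀ {v} → v < m → ∃ λ j → j < m × p j ≡ v
  surjective {v} v<m with injective⇒surjective restrict restrict-injective (fromℕ< v<m)
  ... | j , e = toℕ j , FP.toℕ<n j ,
                trans (sym (FP.toℕ-fromℕ< _)) (trans (cong toℕ e) (FP.toℕ-fromℕ< v<m))

AgreeOn : ℕ → (ℕ → ℕ) → (ℕ → ℕ) → Set
AgreeOn m f g = ∀ i → i < m → f i ≡ g i

module _ {m k : ℕ} where

  private
    -- The value p i sits in q at a tail position j; j < i contradicts injectivity of p,
    -- and j > i gives q i < q j = p i.
    not-below : ∀ {p q} → IsPermOn m p → IsPermOn m q → IncreasingOn q (suc k) m →
                (∀ i → i ≤ k → p i ≡ q i) → ∀ {i} → suc k ≤ i → i < m →
                (∀ {i'} → i' < i → i' < m → p i' ≡ q i') → ¬ p i < q i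
    not-below {p} {q} P Q q-inc p≗q {i} k<i i<m ih pi<qi
      with IsPermOn.surjective Q (IsPermOn.bounded P i<m)
    ... | j , j<m , qj≡pi with j ≤? k
    ... | yes j≤k = <-irrefl (sym (IsPermOn.injective P i<m j<m (trans (sym qj≡pi) (sym (p≗q j j≤k)))))
                             (≤-<-trans j≤k k<i)
    ... | no j≰k with <-cmp j i
    ...   | tri< j<i _ _  = <-irrefl (IsPermOn.injective P j<m i<m (trans (ih j<i j<m) qj≡pi)) j<i
    ...   | tri≈ _ refl _ = <-irrefl (sym qj≡pi) pi<qi
    ...   | tri> _ _ i<j  = <-asym pi<qi (subst (q i <_) qj≡pi (increasing⇒< q-inc k<i i<j j<m))

  increasing-tails-agree : ∀ {p q} → IsPermOn m p → IsPermOn m q →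
                           IncreasingOn p (suc k) m → IncreasingOn q (suc k) m →
                           (∀ i → i ≤ k → p i ≡ q i) → AgreeOn m p q
  increasing-tails-agree {p} {q} P Q p-inc q-inc p≗q = <-rec (λ i → i < m → p i ≡ q i) step
    where
    step : ∀ i → (∀ {i'} → i' < i → i' < m → p i' ≡ q i') → i < m → p i ≡ q i
    step i ih i<m with i ≤? k
    ... | yes i≤k = p≗q i i≤k
    ... | no i≰k with <-cmp (p i) (q i)
    ...   | tri< pi<qi _ _ = ⊥-elim (not-below P Q q-inc p≗q (≰⇒> i≰k) i<m ih pi<qi)
    ...   | tri≈ _ e _     = e
    ...   | tri> _ _ qi<pi = ⊥-elim (not-below Q P p-inc (λ j j≤k → sym (p≗q j j≤k)) (≰⇒> i≰k) i<m
                                               (λ j<i j<m → sym (ih j<i j<m)) qi<pi)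

-- The permutations of the shapes

skip : ℕ → ℕ → ℕ
skip a i = if does (i <? a) then i else suc i

module _ {a : ℕ} where

  skip-< : ∀ {i} → i < a → skip a i ≡ i
  skip-< {i} i<a rewrite dec-true (i <? a) i<a = refl

  skip-≥ : ∀ {i} → a ≤ i → skip a i ≡ suc i
  skip-≥ {i} a≤i rewrite dec-false (i <? a) (≤⇒≯ a≤i) = refl

  skip-≢ : ∀ i → skip a i ≢ a
  skip-≢ i with i <? a
  ... | yes i<a rewrite skip-< i<a = <⇒≢ i<a
  ... | no i≮a rewrite skip-≥ (≮⇒≥ i≮a) = λ e → i≮a (subst (i <_) e ≤-refl)

  skip-≤ : ∀ i → skip a i ≤ suc i
  skip-≤ i with i <? a
  ... | yes i<a rewrite skip-< i<a = n≤1+n i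
  ... | no i≮a rewrite skip-≥ (≮⇒≥ i≮a) = ≤-refl

  skip-mono-< : ∀ {i j} → i < j → skip a i < skip a j
  skip-mono-< {i} {j} i<j with i <? a | j <? a
  ... | yes i<a | yes j<a rewrite skip-< i<a | skip-< j<a = i<j
  ... | yes i<a | no j≮a rewrite skip-< i<a | skip-≥ (≮⇒≥ j≮a) = <-trans i<j (n<1+n j)
  ... | no i≮a | yes j<a = ⊥-elim (i≮a (<-trans i<j j<a))
  ... | no i≮a | no j≮a rewrite skip-≥ (≮⇒≥ i≮a) | skip-≥ (≮⇒≥ j≮a) = s≤s i<j

  skip-mono-≤ : ∀ {i j} → i ≤ j → skip a i ≤ skip a j
  skip-mono-≤ i≤j with m≤n⇒m<n∨m≡n i≤j
  ... | inj₁ i<j  = <⇒≤ (skip-mono-< i<j)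
  ... | inj₂ refl = ≤-refl

  skip-cancel-< : ∀ {i j} → skip a i < skip a j → i < j
  skip-cancel-< lt = ≰⇒> (λ j≤i → <⇒≱ lt (skip-mono-≤ j≤i))

  skip-surjective : ∀ {v} → v ≢ a → ∃ λ i → skip a i ≡ v
  skip-surjective {v} v≢a with <-cmp v a
  ... | tri< v<a _ _ = v , skip-< v<a
  ... | tri≈ _ v≡a _ = ⊥-elim (v≢a v≡a)
  skip-surjective {suc v} v≢a | tri> _ _ a<v = v , skip-≥ (≤-pred a<v)

-- The Schröder word H^a U H^b D H^c corresponds to the permutation with
-- descent at k = a + b that moves the value a from position a to position k + 1.
bump₁ : ℕ → ℕ → ℕ → ℕ
bump₁ a b i = if does (i ≤? a + b) then skip a i else (if does (i ≟ suc (a + b)) then a else i)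

module Bump₁ (a b : ℕ) where
  k : ℕ
  k = a + b

  data Region (i : ℕ) : Set where
    head  : i ≤ k → Region i
    pivot : i ≡ suc k → Region i
    tail  : suc (suc k) ≤ i → Region i

  region : ∀ i → Region i
  region i with i ≤? k
  ... | yes i≤k = head i≤k
  ... | no i≰k with m≤n⇒m<n∨m≡n (≰⇒> i≰k)
  ... | inj₁ lt = tail lt
  ... | inj₂ e  = pivot (sym e)

  on-head : ∀ {i} → i ≤ k → bump₁ a b i ≡ skip a i
  on-head {i} i≤k rewrite dec-true (i ≤? k) i≤k = refl

  on-pivot : bump₁ a b (suc k) ≡ a
  on-pivot rewrite dec-false (suc k ≤? k) 1+n≰n | dec-true (suc k ≟ suc k) refl = refl

  on-tail : ∀ {i} → suc (suc k) ≤ i → bump₁ a b i ≡ i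
  on-tail {i} h rewrite dec-false (i ≤? k) (λ q → 1+n≰n (≤-trans h (≤-trans q (n≤1+n k))))
                      | dec-false (i ≟ suc k) (λ q → 1+n≰n (subst (suc (suc k) ≤_) q h)) = refl

  private
    a<tail : ∀ {i} → suc (suc k) ≤ i → suc a ≤ i
    a<tail h = ≤-trans (s≤s (m≤m+n a b)) (≤-trans (n≤1+n _) h)

  inverse : ℕ → ℕ
  inverse v = if does (v <? a) then v
              else (if does (v ≟ a) then suc k
              else (if does (v ≤? suc k) then v ∸ 1 else v))

  inverse-bump₁ : ∀ i → inverse (bump₁ a b i) ≡ i
  inverse-bump₁ i with region i
  ... | head h with i <? a
  ...   | yes ia rewrite on-head h | skip-< {a} ia | dec-true (i <? a) ia = refl
  ...   | no ia rewrite on-head h | skip-≥ {a} (≮⇒≥ ia)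
                      | dec-false (suc i <? a) (λ q → ia (<-trans (n<1+n i) q))
                      | dec-false (suc i ≟ a) (λ q → ia (subst (i <_) q ≤-refl))
                      | dec-true (suc i ≤? suc k) (s≤s h) = refl
  inverse-bump₁ i | pivot refl rewrite on-pivot | dec-false (a <? a) (n≮n a) | dec-true (a ≟ a) refl = refl
  inverse-bump₁ i | tail h rewrite on-tail h
                    | dec-false (i <? a) (λ q → 1+n≰n (≤-trans (a<tail h) (<⇒≤ q)))
                    | dec-false (i ≟ a) (λ q → 1+n≰n (subst (suc a ≤_) q (a<tail h)))
                    | dec-false (i ≤? suc k) (λ q → 1+n≰n (≤-trans h q)) = refl

  injective : ∀ {i j} → bump₁ a b i ≡ bump₁ a b j → i ≡ j
  injective {i} {j} e = trans (sym (inverse-bump₁ i)) (trans (cong inverse e) (inverse-bump₁ j))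

  bounded : ∀ c {i} → i < suc (suc (k + c)) → bump₁ a b i < suc (suc (k + c))
  bounded c {i} i<m with region i
  ... | head h rewrite on-head h = ≤-<-trans (skip-≤ {a} i) (s≤s (s≤s (≤-trans h (m≤m+n k c))))
  ... | pivot refl rewrite on-pivot = s≤s (≤-trans (m≤m+n a b) (≤-trans (m≤m+n k c) (n≤1+n _)))
  ... | tail h rewrite on-tail h = i<m

  increasing-head : IncreasingOn (bump₁ a b) 0 (suc k)
  increasing-head i _ h rewrite on-head (<⇒≤ (≤-pred h)) | on-head (≤-pred h) = skip-mono-< {a} (n<1+n i)

  increasing-tail : ∀ m → IncreasingOn (bump₁ a b) (suc k) m
  increasing-tail m i l h with region i
  ... | head q = ⊥-elim (1+n≰n (≤-trans l q))
  ... | pivot refl rewrite on-pivot | on-tail {suc (suc k)} ≤-refl = s≤s (≤-trans (m≤m+n a b) (n≤1+n _))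
  ... | tail q rewrite on-tail q | on-tail (≤-trans q (n≤1+n _)) = n<1+n i

  on-k : bump₁ a b k ≡ suc k
  on-k = trans (on-head ≤-refl) (skip-≥ {a} (m≤m+n a b))

  descent : bump₁ a b (suc k) < bump₁ a b k
  descent rewrite on-pivot | on-head {k} ≤-refl | skip-≥ {a} (m≤m+n a b) = s≤s (m≤m+n a b)

  head-≤ : ∀ {i} → i ≤ k → bump₁ a b i ≤ suc k
  head-≤ {i} h rewrite on-head h = ≤-trans (skip-≤ {a} i) (s≤s h)

  tail-≥ : ∀ {i} → suc (suc k) ≤ i → suc (suc k) ≤ bump₁ a b i
  tail-≥ h rewrite on-tail h = h

-- The permutation of H^a U H^b D H^c U H^d D H^e, with descent at k = a + b + d: skip a below
-- position a + b, then d + 1 values from a + b + c + 2 on, then a at position k + 1, then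
-- c + 1 values from a + b + 1 on, and fixed from position a + b + c + d + 3 on.
bump₂ : ℕ → ℕ → ℕ → ℕ → ℕ → ℕ
bump₂ a b c d i =
  if does (i ≤? a + b + d)
  then (if does (i <? a + b) then skip a i else suc (suc (c + i)))
  else (if does (i ≟ suc (a + b + d)) then a
        else (if does (i ≤? suc (suc (c + (a + b + d)))) then i ∸ suc d else i))

module Bump₂ (a b c d : ℕ) where
  k : ℕ
  k = a + b + d
  g : ℕ → ℕ
  g = bump₂ a b c d

  private
    c+k+2 : c + suc (suc k) ≡ suc (suc (c + k))
    c+k+2 = trans (+-suc c (suc k)) (cong suc (+-suc c k))

    fixed⇒k<i : ∀ {i} → suc (suc (suc (c + k))) ≤ i → suc k ≤ i
    fixed⇒k<i h = ≤-trans (s≤s (≤-trans (m≤n+m k c) (≤-trans (n≤1+n _) (n≤1+n _)))) h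

  data Region (i : ℕ) : Set where
    low : i < a + b → Region i
    raised : ∀ t → t ≤ d → i ≡ t + (a + b) → Region i
    pivot : i ≡ suc k → Region i
    lowered : ∀ t → t ≤ c → i ≡ t + suc (suc k) → Region i
    fixed : suc (suc (suc (c + k))) ≤ i → Region i

  region : ∀ i → Region i
  region i with i ≤? k
  ... | yes ik with i <? a + b
  ...   | yes h = low h
  ...   | no h = raised (i ∸ (a + b)) (subst (i ∸ (a + b) ≤_) (m+n∸m≡n (a + b) d) (∸-monoˡ-≤ (a + b) ik))
                    (sym (m∸n+n≡m (≮⇒≥ h)))
  region i | no ik with i ≟ suc k
  ...   | yes e = pivot e
  ...   | no ne with i ≤? suc (suc (c + k))
  ...     | yes h = lowered (i ∸ suc (suc k))
                       (subst (i ∸ suc (suc k) ≤_) (m+n∸n≡m c (suc (suc k)))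
                          (∸-monoˡ-≤ (suc (suc k)) (subst (i ≤_) (sym c+k+2) h)))
                       (sym (m∸n+n≡m (≤∧≢⇒< (≰⇒> ik) (λ e → ne (sym e)))))
  ...     | no h = fixed (≰⇒> h)

  on-low : ∀ {i} → i < a + b → g i ≡ skip a i
  on-low {i} h rewrite dec-true (i ≤? k) (≤-trans (<⇒≤ h) (m≤m+n (a + b) d)) | dec-true (i <? a + b) h = refl

  on-raised : ∀ {t} → t ≤ d → g (t + (a + b)) ≡ suc (suc (c + (t + (a + b))))
  on-raised {t} h rewrite dec-true (t + (a + b) ≤? k) (subst (t + (a + b) ≤_) (+-comm d (a + b)) (+-monoˡ-≤ (a + b) h))
                   | dec-false (t + (a + b) <? a + b) (≤⇒≯ (m≤n+m (a + b) t)) = refl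

  on-pivot : g (suc k) ≡ a
  on-pivot rewrite dec-false (suc k ≤? k) 1+n≰n | dec-true (suc k ≟ suc k) refl = refl

  lowered-shift : ∀ t → t + suc (suc k) ≡ suc (t + (a + b)) + suc d
  lowered-shift t = identity t a b d
    where
    identity : ∀ t a b d → t + suc (suc (a + b + d)) ≡ suc (t + (a + b)) + suc d
    identity = solve-∀

  on-lowered : ∀ {t} → t ≤ c → g (t + suc (suc k)) ≡ suc (t + (a + b))
  on-lowered {t} h rewrite dec-false (t + suc (suc k) ≤? k) (<⇒≱ (≤-trans (n≤1+n _) (m≤n+m (suc (suc k)) t)))
                   | dec-false (t + suc (suc k) ≟ suc k) (>⇒≢ (m≤n+m (suc (suc k)) t))
                   | dec-true (t + suc (suc k) ≤? suc (suc (c + k)))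
                        (subst (t + suc (suc k) ≤_) c+k+2 (+-monoˡ-≤ (suc (suc k)) h))
                   | lowered-shift t = m+n∸n≡m (suc (t + (a + b))) (suc d)

  on-fixed : ∀ {i} → suc (suc (suc (c + k))) ≤ i → g i ≡ i
  on-fixed {i} h rewrite dec-false (i ≤? k) (<⇒≱ (fixed⇒k<i h))
                   | dec-false (i ≟ suc k) (>⇒≢ (≤-trans (s≤s (s≤s (≤-trans (m≤n+m k c) (n≤1+n _)))) h))
                   | dec-false (i ≤? suc (suc (c + k))) (<⇒≱ h) = refl

  private
    ab≤k : a + b ≤ k
    ab≤k = m≤m+n (a + b) d

    ≤-step₂ : ∀ {x y} → x ≤ y → x ≤ suc (suc y)
    ≤-step₂ h = ≤-trans h (≤-trans (n≤1+n _) (n≤1+n _))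

    ab<⇒a≤ : ∀ {V} → suc (a + b) ≤ V → a ≤ V
    ab<⇒a≤ h = ≤-trans (m≤m+n a b) (≤-trans (n≤1+n _) h)

    ab<⇒a< : ∀ {V} → suc (a + b) ≤ V → suc a ≤ V
    ab<⇒a< h = ≤-trans (s≤s (m≤m+n a b)) h

    raised-≥ : ∀ t → suc (suc (c + (a + b))) ≤ suc (suc (c + (t + (a + b))))
    raised-≥ t = s≤s (s≤s (+-monoʳ-≤ c (m≤n+m (a + b) t)))

    raised->ab : ∀ t → suc (a + b) ≤ suc (suc (c + (t + (a + b))))
    raised->ab t = ≤-trans (s≤s (≤-trans (m≤n+m (a + b) c) (n≤1+n _))) (raised-≥ t)

    raised-≤k : ∀ {t} → t ≤ d → t + (a + b) ≤ k
    raised-≤k {t} h = subst (t + (a + b) ≤_) (+-comm d (a + b)) (+-monoˡ-≤ (a + b) h)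

  inverse : ℕ → ℕ
  inverse v = if does (v <? a) then v
         else (if does (v ≟ a) then suc k
         else (if does (v ≤? a + b) then v ∸ 1
         else (if does (v ≤? suc (c + (a + b))) then v + suc d
         else (if does (v ≤? suc (suc (c + k))) then v ∸ suc (suc c) else v))))

  private
    fixed-≥ : ∀ {i} → suc (suc (suc (c + k))) ≤ i → suc (suc (c + (a + b))) ≤ i
    fixed-≥ h = ≤-trans (s≤s (s≤s (≤-trans (+-monoʳ-≤ c ab≤k) (n≤1+n _)))) h
    fixed->ab : ∀ {i} → suc (suc (suc (c + k))) ≤ i → suc (a + b) ≤ i
    fixed->ab h = ≤-trans (s≤s (≤-trans (m≤n+m (a + b) c) (n≤1+n _))) (fixed-≥ h)

  inverse-bump₂ : ∀ i → inverse (g i) ≡ i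
  inverse-bump₂ i with region i
  ... | low h with i <? a
  ...   | yes ia rewrite on-low h | skip-< {a} ia | dec-true (i <? a) ia = refl
  ...   | no ia rewrite on-low h | skip-≥ {a} (≮⇒≥ ia)
                  | dec-false (suc i <? a) (λ q → ia (<-trans (n<1+n i) q))
                  | dec-false (suc i ≟ a) (λ q → ia (subst (i <_) q ≤-refl))
                  | dec-true (suc i ≤? a + b) h = refl
  inverse-bump₂ i | raised t td refl rewrite on-raised td
                  | dec-false (suc (suc (c + (t + (a + b)))) <? a) (≤⇒≯ (ab<⇒a≤ (raised->ab t)))
                  | dec-false (suc (suc (c + (t + (a + b)))) ≟ a) (>⇒≢ (ab<⇒a< (raised->ab t)))
                  | dec-false (suc (suc (c + (t + (a + b)))) ≤? a + b) (<⇒≱ (raised->ab t))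
                  | dec-false (suc (suc (c + (t + (a + b)))) ≤? suc (c + (a + b))) (<⇒≱ (raised-≥ t))
                  | dec-true (suc (suc (c + (t + (a + b)))) ≤? suc (suc (c + k)))
                             (s≤s (s≤s (+-monoʳ-≤ c (raised-≤k td))))
                  = m+n∸m≡n c (t + (a + b))
  inverse-bump₂ i | pivot refl rewrite on-pivot | dec-false (a <? a) (n≮n a) | dec-true (a ≟ a) refl = refl
  inverse-bump₂ i | lowered t tc refl rewrite on-lowered tc
                  | dec-false (suc (t + (a + b)) <? a) (≤⇒≯ (ab<⇒a≤ (s≤s (m≤n+m _ t))))
                  | dec-false (suc (t + (a + b)) ≟ a) (>⇒≢ (ab<⇒a< (s≤s (m≤n+m _ t))))
                  | dec-false (suc (t + (a + b)) ≤? a + b) (<⇒≱ (s≤s (m≤n+m _ t)))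
                  | dec-true (suc (t + (a + b)) ≤? suc (c + (a + b))) (s≤s (+-monoˡ-≤ (a + b) tc))
                  = sym (lowered-shift t)
  inverse-bump₂ i | fixed h rewrite on-fixed h
                  | dec-false (i <? a) (≤⇒≯ (ab<⇒a≤ (fixed->ab h)))
                  | dec-false (i ≟ a) (>⇒≢ (ab<⇒a< (fixed->ab h)))
                  | dec-false (i ≤? a + b) (<⇒≱ (fixed->ab h))
                  | dec-false (i ≤? suc (c + (a + b))) (<⇒≱ (fixed-≥ h))
                  | dec-false (i ≤? suc (suc (c + k))) (<⇒≱ h) = refl

  injective : ∀ {i j} → g i ≡ g j → i ≡ j
  injective {i} {j} e = trans (sym (inverse-bump₂ i)) (trans (cong inverse e) (inverse-bump₂ j))

  small-or-fixed : ∀ i → g i ≤ suc (suc (c + k)) ⊎ g i ≡ i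
  small-or-fixed i with region i
  ... | low h rewrite on-low h = inj₁ (≤-step₂ (≤-trans (skip-≤ {a} i) (≤-trans h (≤-trans ab≤k (m≤n+m k c)))))
  ... | raised t td refl rewrite on-raised td = inj₁ (s≤s (s≤s (+-monoʳ-≤ c (raised-≤k td))))
  ... | pivot refl rewrite on-pivot = inj₁ (≤-step₂ (≤-trans (m≤m+n a b) (≤-trans ab≤k (m≤n+m k c))))
  ... | lowered t tc refl rewrite on-lowered tc =
    inj₁ (≤-trans (s≤s (+-monoˡ-≤ (a + b) tc)) (s≤s (≤-trans (+-monoʳ-≤ c ab≤k) (n≤1+n _))))
  ... | fixed h rewrite on-fixed h = inj₂ refl

  bounded : ∀ m → suc (suc (suc (c + k))) ≤ m → ∀ {i} → i < m → g i < m
  bounded m hm {i} im with small-or-fixed i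
  ... | inj₁ h = ≤-trans (s≤s h) hm
  ... | inj₂ e rewrite e = im

  private
    last-low : ∀ {i} → i < a + b → ¬ suc i < a + b → suc i ≡ a + b
    last-low ih h2 = ≤-antisym ih (≮⇒≥ h2)
    raised-step : ∀ {t} → suc (t + (a + b)) < suc k → suc t ≤ d
    raised-step {t} h = +-cancelˡ-≤ (a + b) (suc t) d (subst (_≤ a + b + d) (+-comm (suc t) (a + b)) (≤-pred h))

    tail-not-in-head : ∀ {i} → suc k ≤ i → suc (suc i) ≤ suc k → ⊥
    tail-not-in-head l h = 1+n≰n (≤-trans (s≤s l) (≤-trans (n≤1+n _) h))

  increasing-head : IncreasingOn g 0 (suc k)
  increasing-head i _ h with region i
  ... | low ih with suc i <? a + b
  ...   | yes h2 rewrite on-low ih | on-low h2 = skip-mono-< {a} (n<1+n i)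
  ...   | no h2 rewrite on-low ih =
          subst (λ x → skip a i < g x) (sym (last-low ih h2)) (subst (skip a i <_) (sym (on-raised {0} z≤n))
            (≤-trans (s≤s (skip-≤ {a} i))
              (s≤s (subst (_≤ suc (c + (a + b))) (sym (last-low ih h2)) (≤-trans (m≤n+m (a + b) c) (n≤1+n _))))))
  increasing-head i _ h | raised t td refl rewrite on-raised td | on-raised {suc t} (raised-step h) =
    s≤s (s≤s (≤-reflexive (sym (+-suc c _))))
  increasing-head i _ h | pivot refl = ⊥-elim (tail-not-in-head ≤-refl h)
  increasing-head i _ h | lowered t tc refl = ⊥-elim (tail-not-in-head (≤-trans (n≤1+n _) (m≤n+m (suc (suc k)) t)) h)
  increasing-head i _ h | fixed hi = ⊥-elim (tail-not-in-head (fixed⇒k<i hi) h)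

  increasing-tail : ∀ M → IncreasingOn g (suc k) M
  increasing-tail M i l h with region i
  ... | low ih = ⊥-elim (1+n≰n (≤-trans l (≤-trans (<⇒≤ ih) ab≤k)))
  ... | raised t td refl = ⊥-elim (1+n≰n (≤-trans l (raised-≤k td)))
  ... | pivot refl rewrite on-pivot | on-lowered {0} z≤n = s≤s (m≤m+n a b)
  ... | fixed hi rewrite on-fixed hi | on-fixed (≤-trans hi (n≤1+n _)) = n<1+n i
  ... | lowered t tc refl with t <? c
  ...   | yes tc' rewrite on-lowered tc | on-lowered {suc t} tc' = n<1+n _
  ...   | no tc' rewrite on-lowered tc | ≤-antisym tc (≮⇒≥ tc')
          | on-fixed {suc (c + suc (suc k))} (s≤s (≤-reflexive (sym c+k+2)))
          = s≤s (≤-trans (s≤s (+-monoʳ-≤ c ab≤k)) (≤-trans (≤-reflexive (sym (+-suc c k))) (+-monoʳ-≤ c (n≤1+n _))))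

  on-k : g k ≡ suc (suc (c + k))
  on-k = subst (λ x → g x ≡ suc (suc (c + x))) (+-comm d (a + b)) (on-raised {d} ≤-refl)

  descent : g (suc k) < g k
  descent rewrite on-pivot = subst (λ x → a < g x) (+-comm d (a + b))
                         (subst (a <_) (sym (on-raised {d} ≤-refl)) (≤-trans (ab<⇒a< (raised->ab d)) ≤-refl))

  head-≤ : ∀ {i} → i ≤ k → g i ≤ suc (suc (c + k))
  head-≤ {i} ik with small-or-fixed i
  ... | inj₁ h = h
  ... | inj₂ e rewrite e = ≤-step₂ (≤-trans ik (m≤n+m k c))

  head-gap : ∀ {i} → i ≤ k → suc (suc (a + b)) ≤ g i → suc (suc (c + (a + b))) ≤ g i
  head-gap {i} ik h with region i
  ... | low ih rewrite on-low ih = ⊥-elim (1+n≰n (≤-trans (≤-trans (n≤1+n _) h) (≤-trans (skip-≤ {a} i) ih)))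
  ... | raised t td refl rewrite on-raised td = raised-≥ t
  ... | pivot refl = ⊥-elim (1+n≰n ik)
  ... | lowered t tc refl = ⊥-elim (1+n≰n (≤-trans (≤-trans (n≤1+n _) (m≤n+m (suc (suc k)) t)) ik))
  ... | fixed hi = ⊥-elim (1+n≰n (≤-trans (fixed⇒k<i hi) ik))

  tail-≥ : ∀ {i} → suc (suc k) ≤ i → suc (a + b) ≤ g i
  tail-≥ {i} l with region i
  ... | low ih = ⊥-elim (1+n≰n (≤-trans (≤-trans (n≤1+n _) l) (≤-trans (<⇒≤ ih) ab≤k)))
  ... | raised t td refl = ⊥-elim (1+n≰n (≤-trans (≤-trans (n≤1+n _) l) (raised-≤k td)))
  ... | pivot refl = ⊥-elim (1+n≰n l)
  ... | lowered t tc refl rewrite on-lowered tc = s≤s (m≤n+m _ t)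
  ... | fixed hi rewrite on-fixed hi = fixed->ab hi

  tail-gap : ∀ {i} → suc (suc k) ≤ i → suc (suc (suc (c + (a + b)))) ≤ g i → suc (suc (suc (c + k))) ≤ g i
  tail-gap {i} l h with region i
  ... | low ih = ⊥-elim (1+n≰n (≤-trans (≤-trans (n≤1+n _) l) (≤-trans (<⇒≤ ih) ab≤k)))
  ... | raised t td refl = ⊥-elim (1+n≰n (≤-trans (≤-trans (n≤1+n _) l) (raised-≤k td)))
  ... | pivot refl = ⊥-elim (1+n≰n l)
  ... | lowered t tc refl rewrite on-lowered tc =
    ⊥-elim (1+n≰n (≤-trans h (s≤s (≤-trans (+-monoˡ-≤ (a + b) tc) (n≤1+n _)))))
  ... | fixed hi rewrite on-fixed hi = hi

  -- A 35124 occurrence with 3, 5 in the head and 1, 2, 4 in the tail: the 2 exceeds a + b, so the 3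
  -- lies in the raised block, so the 4 lies in the fixed part, above every head value, including the 5.
  avoids : ∀ {i₁ i₂ i₃ i₄ i₅} → i₁ ≤ k → i₂ ≤ k → suc k ≤ i₃ → i₃ < i₄ → i₄ < i₅ →
           g i₄ < g i₁ → g i₁ < g i₅ → g i₅ < g i₂ → ⊥
  avoids {i₁} {i₂} {i₃} {i₄} {i₅} i₁≤k i₂≤k k<i₃ i₃<i₄ i₄<i₅ v₄₁ v₁₅ v₅₂ =
    1+n≰n (≤-trans (≤-trans (s≤s (n≤1+n _)) (≤-trans (s≤s four) v₅₂)) (head-≤ i₂≤k))
    where
    k+1<i₄ : suc (suc k) ≤ i₄
    k+1<i₄ = ≤-trans (s≤s k<i₃) i₃<i₄
    three : suc (suc (c + (a + b))) ≤ g i₁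
    three = head-gap i₁≤k (≤-trans (s≤s (tail-≥ k+1<i₄)) v₄₁)
    four : suc (suc (suc (c + k))) ≤ g i₅
    four = tail-gap (≤-trans k+1<i₄ (<⇒≤ i₄<i₅)) (≤-trans (s≤s three) v₁₅)

data Shape (n : ℕ) : Set where
  flat      : Shape n
  one-bump  : (a b c : ℕ) → a + b + c + 1 ≡ n → Shape n
  two-bumps : (a b c d e : ℕ) → a + b + c + d + e + 2 ≡ n → Shape n

shapePerm : ∀ {n} → Shape n → ℕ → ℕ
shapePerm flat                    i = i
shapePerm (one-bump a b _ _)        = bump₁ a b
shapePerm (two-bumps a b c d _ _)   = bump₂ a b c d

one-bump-fits : ∀ {n} a b c → a + b + c + 1 ≡ n → suc (suc (a + b)) ≤ suc n
one-bump-fits {n} a b c eq =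
  subst (suc (suc (a + b)) ≤_) (cong suc (trans (+-comm 1 (a + b + c)) eq)) (s≤s (s≤s (m≤m+n (a + b) c)))

two-bumps-fits : ∀ {n} a b c d e → a + b + c + d + e + 2 ≡ n → suc (suc (suc (c + (a + b + d)))) ≤ suc n
two-bumps-fits {n} a b c d e eq =
  subst (suc (suc (suc (c + (a + b + d)))) ≤_) (trans (identity a b c d e) (cong suc eq)) (m≤m+n _ e)
  where
  identity : ∀ a b c d e → suc (suc (suc (c + (a + b + d)))) + e ≡ suc (a + b + c + d + e + 2)
  identity = solve-∀

record IsGrassAvoidOn (m : ℕ) (p : ℕ → ℕ) : Set where
  field
    isPermOn     : IsPermOn m p
    grassmannian : ∀ {i j} → suc i < m → suc j < m → p (suc i) < p i → p (suc j) < p j → i ≡ j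
    avoids       : ∀ {i₁ i₂ i₃ i₄ i₅} → i₁ < i₂ → i₂ < i₃ → i₃ < i₄ → i₄ < i₅ → i₅ < m →
                   p i₃ < p i₄ → p i₄ < p i₁ → p i₁ < p i₅ → p i₅ < p i₂ → ⊥

  open IsPermOn isPermOn public

module TwoRuns {m k : ℕ} {p : ℕ → ℕ} (head↑ : IncreasingOn p 0 (suc k)) (tail↑ : IncreasingOn p (suc k) m) where

  descent-at-k : ∀ {i} → suc i < m → p (suc i) < p i → i ≡ k
  descent-at-k {i} si<m desc with <-cmp i k
  ... | tri< i<k _ _ = ⊥-elim (<-asym desc (head↑ i z≤n (s≤s i<k)))
  ... | tri≈ _ i≡k _ = i≡k
  ... | tri> _ _ k<i = ⊥-elim (<-asym desc (tail↑ i k<i si<m))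

  grassmannian : ∀ {i j} → suc i < m → suc j < m → p (suc i) < p i → p (suc j) < p j → i ≡ j
  grassmannian si<m sj<m di dj = trans (descent-at-k si<m di) (sym (descent-at-k sj<m dj))

  inversion-straddles : ∀ {i j} → i < j → j < m → p j < p i → i ≤ k × suc k ≤ j
  inversion-straddles i<j j<m inv =
    ≮⇒≥ (λ k<i → <-asym inv (increasing⇒< tail↑ k<i i<j j<m)) ,
    ≰⇒> (λ j≤k → <-asym inv (increasing⇒< head↑ z≤n i<j (s≤s j≤k)))

  pattern-straddles : ∀ {i₁ i₂ i₃ i₄ i₅} → i₁ < i₂ → i₂ < i₃ → i₃ < i₄ → i₄ < i₅ → i₅ < m →
                      p i₃ < p i₄ → p i₄ < p i₁ → p i₁ < p i₅ → p i₅ < p i₂ →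
                      i₁ ≤ k × i₂ ≤ k × suc k ≤ i₃
  pattern-straddles {i₁} {i₂} {i₃} i₁<i₂ i₂<i₃ i₃<i₄ i₄<i₅ i₅<m v₃₄ v₄₁ v₁₅ v₅₂ =
    proj₁ first , proj₁ (inversion-straddles i₂<i₃ i₃<m (<-trans v₃₄ (<-trans v₄₁ (<-trans v₁₅ v₅₂)))) ,
    proj₂ first
    where
    i₃<m : i₃ < m
    i₃<m = <-trans i₃<i₄ (<-trans i₄<i₅ i₅<m)
    first : i₁ ≤ k × suc k ≤ i₃
    first = inversion-straddles (<-trans i₁<i₂ i₂<i₃) i₃<m (<-trans v₃₄ v₄₁)

shapePerm-isGrassAvoid : ∀ {n} (s : Shape n) → IsGrassAvoidOn (suc n) (shapePerm s)
shapePerm-isGrassAvoid flat = record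
  { isPermOn     = record { bounded = λ i<m → i<m ; injective = λ _ _ e → e }
  ; grassmannian = λ _ _ desc _ → ⊥-elim (1+n≰n (<⇒≤ desc))
  ; avoids       = λ i₁<i₂ i₂<i₃ i₃<i₄ _ _ _ v₄₁ _ _ → <-asym v₄₁ (<-trans i₁<i₂ (<-trans i₂<i₃ i₃<i₄))
  }
shapePerm-isGrassAvoid {n} (one-bump a b c eq) = record
  { isPermOn     = record { bounded = bounded ; injective = λ _ _ → Bump₁.injective a b }
  ; grassmannian = R.grassmannian
  ; avoids       = avoids
  }
  where
  module R = TwoRuns {suc n} (Bump₁.increasing-head a b) (Bump₁.increasing-tail a b (suc n))
  size : suc n ≡ suc (suc (a + b + c))
  size = cong suc (trans (sym eq) (+-comm (a + b + c) 1))
  bounded : ∀ {i} → i < suc n → bump₁ a b i < suc n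
  bounded {i} i<m = subst (bump₁ a b i <_) (sym size) (Bump₁.bounded a b c (subst (i <_) size i<m))
  g : ℕ → ℕ
  g = bump₁ a b
  -- The 2 lies in the fixed part of the tail, above every head value, in particular above the 3.
  avoids : ∀ {i₁ i₂ i₃ i₄ i₅} → i₁ < i₂ → i₂ < i₃ → i₃ < i₄ → i₄ < i₅ → i₅ < suc n →
           g i₃ < g i₄ → g i₄ < g i₁ → g i₁ < g i₅ → g i₅ < g i₂ → ⊥
  avoids i₁<i₂ i₂<i₃ i₃<i₄ i₄<i₅ i₅<m v₃₄ v₄₁ v₁₅ v₅₂
    with i₁≤k , _ , k<i₃ ← R.pattern-straddles i₁<i₂ i₂<i₃ i₃<i₄ i₄<i₅ i₅<m v₃₄ v₄₁ v₁₅ v₅₂ =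
    <⇒≱ (≤-trans (n≤1+n _) (≤-trans (s≤s (Bump₁.tail-≥ a b (≤-trans (s≤s k<i₃) i₃<i₄))) v₄₁))
        (Bump₁.head-≤ a b i₁≤k)
shapePerm-isGrassAvoid {n} (two-bumps a b c d e eq) = record
  { isPermOn     = record { bounded = Bump₂.bounded a b c d (suc n) (two-bumps-fits a b c d e eq)
                          ; injective = λ _ _ → Bump₂.injective a b c d }
  ; grassmannian = R.grassmannian
  ; avoids       = avoids
  }
  where
  module R = TwoRuns {suc n} (Bump₂.increasing-head a b c d) (Bump₂.increasing-tail a b c d (suc n))
  g : ℕ → ℕ
  g = bump₂ a b c d
  avoids : ∀ {i₁ i₂ i₃ i₄ i₅} → i₁ < i₂ → i₂ < i₃ → i₃ < i₄ → i₄ < i₅ → i₅ < suc n →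
           g i₃ < g i₄ → g i₄ < g i₁ → g i₁ < g i₅ → g i₅ < g i₂ → ⊥
  avoids i₁<i₂ i₂<i₃ i₃<i₄ i₄<i₅ i₅<m v₃₄ v₄₁ v₁₅ v₅₂
    with i₁≤k , i₂≤k , k<i₃ ← R.pattern-straddles i₁<i₂ i₂<i₃ i₃<i₄ i₄<i₅ i₅<m v₃₄ v₄₁ v₁₅ v₅₂ =
    Bump₂.avoids a b c d i₁≤k i₂≤k k<i₃ i₃<i₄ i₄<i₅ v₄₁ v₁₅ v₅₂

-- Every Grassmannian 35124-avoiding permutation has a shape

ShapeOf : (n : ℕ) → (ℕ → ℕ) → Set
ShapeOf n p = Σ (Shape n) λ s → AgreeOn (suc n) p (shapePerm s)

module NoDescent {n : ℕ} {p : ℕ → ℕ} (G : IsGrassAvoidOn (suc n) p)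
                 (ascent : ∀ i → i < n → ¬ p (suc i) < p i) where
  open IsGrassAvoidOn G

  increasing : IncreasingOn p 0 (suc n)
  increasing i _ si<m = ≤∧≢⇒< (≮⇒≥ (ascent i (≤-pred si<m)))
                              (λ e → <-irrefl (injective (<-trans (n<1+n i) si<m) si<m e) (n<1+n i))

  identity : AgreeOn (suc n) p (λ i → i)
  identity i i<m =
    ≤-antisym (increasing⇒≤-shift increasing 0 z≤n (≤-pred i<m) ≤-refl (≤-pred (bounded ≤-refl)))
              (≤-trans (m≤m+n i (p 0)) (increasing⇒gap increasing z≤n z≤n i<m))

  shapeOf : ShapeOf n p
  shapeOf = flat , identity

module DescentAt {n : ℕ} {p : ℕ → ℕ} (G : IsGrassAvoidOn (suc n) p)
                 (k : ℕ) (sk<m : suc k < suc n) (desc : p (suc k) < p k) where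
  open IsGrassAvoidOn G

  m : ℕ
  m = suc n

  k<m : k < m
  k<m = <-trans (n<1+n k) sk<m

  ≤k⇒<m : ∀ {j} → j ≤ k → j < m
  ≤k⇒<m j≤k = ≤-<-trans j≤k k<m

  ascent : ∀ i → suc i < m → i ≢ k → p i < p (suc i)
  ascent i si<m i≢k = ≤∧≢⇒< (≮⇒≥ (λ d → i≢k (grassmannian si<m sk<m d desc)))
                            (λ e → <-irrefl (injective (<-trans (n<1+n i) si<m) si<m e) (n<1+n i))

  head↑ : IncreasingOn p 0 (suc k)
  head↑ i _ si≤k = ascent i (<-trans si≤k sk<m) (<⇒≢ (≤-pred si≤k))

  tail↑ : IncreasingOn p (suc k) m
  tail↑ i k<i si<m = ascent i si<m (λ e → <-irrefl (sym e) k<i)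

  a : ℕ
  a = p (suc k)

  ≤-head : ∀ {i} → i ≤ k → i ≤ p i
  ≤-head {i} i≤k = ≤-trans (m≤m+n i (p 0)) (increasing⇒gap head↑ z≤n z≤n (s≤s i≤k))

  position-of-a : ∀ {j} → j < m → p j ≡ a → j ≡ suc k
  position-of-a j<m e = injective j<m sk<m e

  head-≢a : ∀ {i} → i < k → p i ≢ a
  head-≢a {i} i<k e = 1+n≰n (≤-trans (n≤1+n _) (subst (λ x → suc x ≤ k) (position-of-a (≤k⇒<m (<⇒≤ i<k)) e) i<k))

  below-a-in-head : ∀ u → u < a → u ≢ a → ∃ λ j → j ≤ k × p j ≡ u
  below-a-in-head u u<a _ with surjective (<-trans u<a (bounded sk<m))
  ... | j , j<m , pj≡u with j ≤? k
  ... | yes j≤k = j , j≤k , pj≡u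
  ... | no j≰k = ⊥-elim (<⇒≱ u<a (subst (a ≤_) pj≡u (increasing⇒≤ tail↑ ≤-refl (≰⇒> j≰k) j<m)))

  -- If every value below T other than a is taken in the head, the head starts with skip a: by strong
  -- induction, skip a i is taken at some j ≤ k, and j < i or j > i contradicts injectivity or monotonicity.
  module HeadBelow (T : ℕ) (in-head : ∀ u → u < T → u ≢ a → ∃ λ j → j ≤ k × p j ≡ u) where

    Skipping : ℕ → Set
    Skipping i = skip a i < T → i ≤ k × p i ≡ skip a i

    private
      not-later : ∀ i j → (∀ {i'} → i' < i → Skipping i') → skip a i < T → j ≤ k → p j ≡ skip a i → i < j → ⊥
      not-later i j ih i<T j≤k pj≡ i<j with skip-surjective {a} {p i} (head-≢a (<-≤-trans i<j j≤k))
      ... | t , skip-t≡pi =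
        <-irrefl (injective (≤k⇒<m (<⇒≤ (<-trans t<i (<-≤-trans i<j j≤k)))) (≤k⇒<m (<⇒≤ (<-≤-trans i<j j≤k)))
                            (trans (proj₂ (ih t<i (<-trans (skip-mono-< {a} t<i) i<T))) skip-t≡pi)) t<i
        where
        t<i : t < i
        t<i = skip-cancel-< {a} (subst (_< skip a i) (sym skip-t≡pi)
                (subst (p i <_) pj≡ (increasing⇒< head↑ z≤n i<j (s≤s j≤k))))

    skipping : ∀ i → Skipping i
    skipping = <-rec Skipping step
      where
      step : ∀ i → (∀ {i'} → i' < i → Skipping i') → Skipping i
      step i ih i<T with in-head (skip a i) i<T (skip-≢ i)
      ... | j , j≤k , pj≡ with <-cmp j i
      ... | tri< j<i _ _  = ⊥-elim (<⇒≢ (skip-mono-< {a} j<i)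
                              (trans (sym (proj₂ (ih j<i (<-trans (skip-mono-< {a} j<i) i<T)))) pj≡))
      ... | tri≈ _ refl _ = j≤k , pj≡
      ... | tri> _ _ i<j  = ⊥-elim (not-later i j ih i<T j≤k pj≡ i<j)

  below-a-fixed : ∀ {i} → i < a → i ≤ k × p i ≡ i
  below-a-fixed {i} i<a =
    subst (λ x → i ≤ k × p i ≡ x) (skip-< i<a)
      (HeadBelow.skipping a below-a-in-head i (subst (_< a) (sym (skip-< i<a)) i<a))

  a≤k : a ≤ k
  a≤k = ≮⇒≥ (λ k<a → <-asym (subst (a <_) (proj₂ (below-a-fixed k<a)) desc) k<a)

  head-above-a : ∀ {i} → a ≤ i → i ≤ k → suc i ≤ p i
  head-above-a {i} a≤i i≤k =
    ≤-trans (≤-reflexive e) (≤-trans (+-monoʳ-≤ (i ∸ a) a<pa) (increasing⇒gap head↑ z≤n a≤i (s≤s i≤k)))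
    where
    a<pa : suc a ≤ p a
    a<pa = ≤∧≢⇒< (≤-head a≤k) (λ e → 1+n≰n (subst (_≤ k) (position-of-a (≤k⇒<m a≤k) (sym e)) a≤k))
    e : suc i ≡ (i ∸ a) + suc a
    e = sym (trans (+-suc (i ∸ a) a) (cong suc (m∸n+n≡m a≤i)))

  k<pk : suc k ≤ p k
  k<pk = head-above-a a≤k ≤-refl

  module OneBump (pk≡ : p k ≡ suc k) where

    head : ∀ {i} → i ≤ k → p i ≡ skip a i
    head {i} i≤k with i <? a
    ... | yes i<a = trans (proj₂ (below-a-fixed i<a)) (sym (skip-< i<a))
    ... | no i≮a rewrite skip-≥ {a} (≮⇒≥ i≮a) =
      ≤-antisym (increasing⇒≤-shift head↑ 1 z≤n i≤k ≤-refl (≤-reflexive pk≡)) (head-above-a (≮⇒≥ i≮a) i≤k)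

    b : ℕ
    b = k ∸ a

    c : ℕ
    c = n ∸ suc k

    k≡a+b : a + b ≡ k
    k≡a+b = m+[n∸m]≡n a≤k

    size : a + b + c + 1 ≡ n
    size = trans (+-comm (a + b + c) 1) (trans (cong (λ x → suc (x + c)) k≡a+b) (m+[n∸m]≡n (≤-pred sk<m)))

    shapeOf : ShapeOf n p
    shapeOf = one-bump a b c size ,
      increasing-tails-agree isPermOn (IsGrassAvoidOn.isPermOn (shapePerm-isGrassAvoid (one-bump a b c size)))
        tail↑ (subst (λ x → IncreasingOn (bump₁ a b) (suc x) m) k≡a+b (Bump₁.increasing-tail a b m))
        (λ i i≤k → trans (head i≤k) (sym (Bump₁.on-head a b (subst (i ≤_) (sym k≡a+b) i≤k))))

  -- Otherwise p k ≥ k + 2, so position k + 2 exists, and the values below y = p (k + 2) other than a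
  -- lie in the head.
  module TwoBumps (pk≢ : p k ≢ suc k) where

    k+1<pk : suc (suc k) ≤ p k
    k+1<pk = ≤∧≢⇒< k<pk (λ e → pk≢ (sym e))

    k+2<m : suc (suc k) < m
    k+2<m = ≤-<-trans k+1<pk (bounded k<m)

    y : ℕ
    y = p (suc (suc k))

    a<y : a < y
    a<y = tail↑ (suc k) ≤-refl k+2<m

    below-y-in-head : ∀ u → u < y → u ≢ a → ∃ λ j → j ≤ k × p j ≡ u
    below-y-in-head u u<y u≢a = in-head (surjective (<-trans u<y (bounded k+2<m)))
      where
      not-in-tail : ∀ {j} → suc k ≤ j → j < m → p j ≢ u
      not-in-tail {j} k<j j<m pj≡u with <-cmp j (suc (suc k))
      ... | tri< j<k+2 _ _ = u≢a (trans (sym pj≡u) (cong p (≤-antisym (≤-pred j<k+2) k<j)))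
      ... | tri≈ _ j≡k+2 _ = <-irrefl (trans (sym pj≡u) (cong p j≡k+2)) u<y
      ... | tri> _ _ k+2<j = <-asym u<y (subst (y <_) pj≡u (increasing⇒< tail↑ (n≤1+n _) k+2<j j<m))
      in-head : (∃ λ j → j < m × p j ≡ u) → ∃ λ j → j ≤ k × p j ≡ u
      in-head (j , j<m , pj≡u) with j ≤? k
      ... | yes j≤k = j , j≤k , pj≡u
      ... | no j≰k  = ⊥-elim (not-in-tail (≰⇒> j≰k) j<m pj≡u)

    b : ℕ
    b = y ∸ suc a

    y≡a+b+1 : suc (a + b) ≡ y
    y≡a+b+1 = m+[n∸m]≡n a<y

    low : ∀ {i} → i < a + b → i ≤ k × p i ≡ skip a i
    low {i} i<ab = HeadBelow.skipping y below-y-in-head i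
                     (≤-<-trans (skip-≤ {a} i) (subst (suc i <_) y≡a+b+1 (s≤s i<ab)))

    a+b≤k : a + b ≤ k
    a+b≤k = ≮⇒≥ (λ k<ab → 1+n≰n (subst (suc (suc k) ≤_) (trans (proj₂ (low k<ab)) (skip-≥ {a} a≤k)) k+1<pk))

    y<p-ab : y < p (a + b)
    y<p-ab = ≤∧≢⇒< (≮⇒≥ p-ab≮y) y≢p-ab
      where
      y≢p-ab : y ≢ p (a + b)
      y≢p-ab e = 1+n≰n (≤-trans (n≤1+n _) (subst (_≤ k) (sym (injective k+2<m (≤k⇒<m a+b≤k) e)) a+b≤k))
      p-ab≮y : ¬ p (a + b) < y
      p-ab≮y lt = not-skip (skip-surjective {a} {p (a + b)}
                    (λ e → 1+n≰n (subst (_≤ k) (position-of-a (≤k⇒<m a+b≤k) e) a+b≤k)))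
        where
        not-skip : (∃ λ t → skip a t ≡ p (a + b)) → ⊥
        not-skip (t , skip-t≡) =
          <-irrefl (injective (≤k⇒<m (<⇒≤ (<-≤-trans t<ab a+b≤k))) (≤k⇒<m a+b≤k)
                              (trans (proj₂ (low t<ab)) skip-t≡)) t<ab
          where
          t<ab : t < a + b
          t<ab = ≰⇒> (λ ab≤t → <⇒≱ lt (subst (y ≤_) skip-t≡ (subst (_≤ skip a t) y≡a+b+1
                   (subst (suc (a + b) ≤_) (sym (skip-≥ {a} (≤-trans (m≤m+n a b) ab≤t))) (s≤s ab≤t)))))

    y<raised : ∀ {i} → a + b ≤ i → i ≤ k → y < p i
    y<raised ab≤i i≤k = <-≤-trans y<p-ab (increasing⇒≤ head↑ z≤n ab≤i (s≤s i≤k))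

    private
      no-head-value-between : ∀ {i j} → suc i ≤ k → j ≤ k → p i < p j → p j < p (suc i) → ⊥
      no-head-value-between {i} {j} si≤k j≤k pi<pj pj<psi with j ≤? i
      ... | yes j≤i = <⇒≱ pi<pj (increasing⇒≤ head↑ z≤n j≤i (s≤s (<⇒≤ si≤k)))
      ... | no j≰i  = <⇒≱ pj<psi (increasing⇒≤ head↑ z≤n (≰⇒> j≰i) (s≤s j≤k))

    -- A value skipped by the raised run lies in the tail beyond position k + 2, and positions
    -- i, i + 1, k + 1, k + 2 and its position form a 35124.
    raised-step : ∀ {i} → a + b ≤ i → i < k → p (suc i) ≡ suc (p i)
    raised-step {i} ab≤i i<k with <-cmp (suc (p i)) (p (suc i))
    ... | tri≈ _ e _  = sym e
    ... | tri> _ _ gt = ⊥-elim (1+n≰n (≤-trans gt (head↑ i z≤n (s≤s i<k))))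
    ... | tri< lt _ _ = ⊥-elim (nowhere (surjective (<-trans lt (bounded (≤-<-trans i<k k<m)))))
      where
      y<pi : y < p i
      y<pi = y<raised ab≤i (<⇒≤ i<k)
      nowhere : (∃ λ j → j < m × p j ≡ suc (p i)) → ⊥
      nowhere (j , j<m , pj≡) = located (subst (p i <_) (sym pj≡) (n<1+n _)) (subst (_< p (suc i)) (sym pj≡) lt)
        where
        located : p i < p j → p j < p (suc i) → ⊥
        located pi<pj pj<psi with j ≤? k
        ... | yes j≤k = no-head-value-between i<k j≤k pi<pj pj<psi
        ... | no j≰k with <-cmp j (suc (suc k))
        ...   | tri< j<k+2 _ _ =
                <-asym (subst (_< y) (trans (sym (cong p (≤-antisym (≤-pred j<k+2) (≰⇒> j≰k)))) pj≡) a<y)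
                       (<-trans y<pi (n<1+n _))
        ...   | tri≈ _ j≡k+2 _ = <-asym y<pi (subst (p i <_) (trans (sym pj≡) (cong p j≡k+2)) (n<1+n _))
        ...   | tri> _ _ k+2<j = avoids (n<1+n i) (s≤s i<k) (n<1+n _) k+2<j j<m a<y y<pi pi<pj pj<psi

    raised-run : ∀ t → t + (a + b) ≤ k → p (t + (a + b)) ≡ t + p (a + b)
    raised-run zero    _ = refl
    raised-run (suc t) h = trans (raised-step (m≤n+m (a + b) t) h) (cong suc (raised-run t (≤-trans (n≤1+n _) h)))

    c : ℕ
    c = p (a + b) ∸ suc (suc (a + b))

    d : ℕ
    d = k ∸ (a + b)

    p-ab≡ : p (a + b) ≡ suc (suc (c + (a + b)))
    p-ab≡ = trans (sym (m∸n+n≡m a+b+1<p-ab)) (trans (+-suc c (suc (a + b))) (cong suc (+-suc c (a + b))))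
      where
      a+b+1<p-ab : suc (suc (a + b)) ≤ p (a + b)
      a+b+1<p-ab = subst (λ x → suc x ≤ p (a + b)) (sym y≡a+b+1) y<p-ab

    k≡a+b+d : a + b + d ≡ k
    k≡a+b+d = m+[n∸m]≡n a+b≤k

    head : ∀ i → i ≤ k → p i ≡ bump₂ a b c d i
    head i i≤k with i <? a + b
    ... | yes i<ab = trans (proj₂ (low i<ab)) (sym (Bump₂.on-low a b c d i<ab))
    ... | no i≮ab = subst (λ x → p x ≡ bump₂ a b c d x) (sym i≡)
                      (trans (raised-run t (subst (_≤ k) i≡ i≤k))
                      (trans (cong (t +_) p-ab≡) (trans (shift t c (a + b)) (sym (Bump₂.on-raised a b c d t≤d)))))
      where
      t : ℕ
      t = i ∸ (a + b)
      i≡ : i ≡ t + (a + b)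
      i≡ = sym (m∸n+n≡m (≮⇒≥ i≮ab))
      t≤d : t ≤ d
      t≤d = ∸-monoˡ-≤ (a + b) i≤k
      shift : ∀ t c x → t + suc (suc (c + x)) ≡ suc (suc (c + (t + x)))
      shift = solve-∀

    p-k<m : suc (suc (suc (c + (a + b + d)))) ≤ m
    p-k<m = subst (_< m) (trans (head (a + b + d) (≤-reflexive k≡a+b+d)) (Bump₂.on-k a b c d))
              (subst (λ x → p x < m) (sym k≡a+b+d) (bounded k<m))

    e : ℕ
    e = n ∸ suc (suc (c + (a + b + d)))

    size : a + b + c + d + e + 2 ≡ n
    size = trans (identity a b c d e) (m∸n+n≡m (≤-pred p-k<m))
      where
      identity : ∀ a b c d e → a + b + c + d + e + 2 ≡ e + suc (suc (c + (a + b + d)))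
      identity = solve-∀

    shapeOf : ShapeOf n p
    shapeOf = two-bumps a b c d e size ,
      increasing-tails-agree isPermOn (IsGrassAvoidOn.isPermOn (shapePerm-isGrassAvoid (two-bumps a b c d e size)))
        tail↑ (subst (λ x → IncreasingOn (bump₂ a b c d) (suc x) m) k≡a+b+d (Bump₂.increasing-tail a b c d m))
        head

  shapeOf : ShapeOf n p
  shapeOf with p k ≟ suc k
  ... | yes pk≡ = OneBump.shapeOf pk≡
  ... | no pk≢  = TwoBumps.shapeOf pk≢

grassAvoid⇒shape : ∀ {n p} → IsGrassAvoidOn (suc n) p → ShapeOf n p
grassAvoid⇒shape {n} {p} G with anyUpTo? (λ i → p (suc i) <? p i) n
... | no none               = NoDescent.shapeOf G (λ i i<n desc → none (i , i<n , desc))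
... | yes (k , k<n , desc)  = DescentAt.shapeOf G k (s≤s k<n) desc

-- Distinct shapes give distinct permutations

agree-descent : ∀ {m f g k} → AgreeOn m f g → suc k < m → g (suc k) < g k → f (suc k) < f k
agree-descent {k = k} f≗g sk<m desc =
  subst₂ _<_ (sym (f≗g (suc k) sk<m)) (sym (f≗g k (<-trans (n<1+n k) sk<m))) desc

agree-sym : ∀ {m f g} → AgreeOn m f g → AgreeOn m g f
agree-sym f≗g i i<m = sym (f≗g i i<m)

identity-no-descent : ∀ {m g k} → AgreeOn m (λ i → i) g → suc k < m → g (suc k) < g k → ⊥
identity-no-descent id≗g sk<m desc = 1+n≰n (<⇒≤ (agree-descent id≗g sk<m desc))

same-descent : ∀ {n} (s : Shape n) {g k k'} → AgreeOn (suc n) (shapePerm s) g →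
               suc k < suc n → shapePerm s (suc k) < shapePerm s k → suc k' < suc n → g (suc k') < g k' → k ≡ k'
same-descent s s≗g sk<m desc sk'<m desc' =
  IsGrassAvoidOn.grassmannian (shapePerm-isGrassAvoid s) sk<m sk'<m desc (agree-descent s≗g sk'<m desc')

two-bumps-k+2<m : ∀ {n} a b c d e → a + b + c + d + e + 2 ≡ n → suc (suc (a + b + d)) < suc n
two-bumps-k+2<m a b c d e eq = ≤-trans (s≤s (s≤s (s≤s (m≤n+m _ c)))) (two-bumps-fits a b c d e eq)

one-bump-≡ : ∀ {n a b c a' b' c'} {eq : a + b + c + 1 ≡ n} {eq' : a' + b' + c' + 1 ≡ n} →
             a ≡ a' → b ≡ b' → one-bump a b c eq ≡ one-bump a' b' c' eq'
one-bump-≡ {a = a} {b} {c} {c' = c'} {eq} {eq'} refl refl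
  with +-cancelˡ-≡ (a + b) c c' (+-cancelʳ-≡ 1 (a + b + c) (a + b + c') (trans eq (sym eq')))
... | refl = cong (one-bump a b c) (≡-irrelevant eq eq')

two-bumps-≡ : ∀ {n a b c d e a' b' c' d' e'}
              {eq : a + b + c + d + e + 2 ≡ n} {eq' : a' + b' + c' + d' + e' + 2 ≡ n} →
              a ≡ a' → b ≡ b' → c ≡ c' → d ≡ d' → two-bumps a b c d e eq ≡ two-bumps a' b' c' d' e' eq'
two-bumps-≡ {a = a} {b} {c} {d} {e} {e' = e'} {eq} {eq'} refl refl refl refl
  with +-cancelˡ-≡ (a + b + c + d) e e'
         (+-cancelʳ-≡ 2 (a + b + c + d + e) (a + b + c + d + e') (trans eq (sym eq')))
... | refl = cong (two-bumps a b c d e) (≡-irrelevant eq eq')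

-- bump₁ and bump₂ have their descent at the same position k, where bump₁ takes k + 1 and bump₂ k + c + 2.
one-bump-≢-two-bumps : ∀ {n a b c a' b' c' d' e'} (eq : a + b + c + 1 ≡ n)
                       (eq' : a' + b' + c' + d' + e' + 2 ≡ n) →
                       ¬ AgreeOn (suc n) (bump₁ a b) (bump₂ a' b' c' d')
one-bump-≢-two-bumps {n} {a} {b} {c} {a'} {b'} {c'} {d'} {e'} eq eq' agree =
  m≢1+n+m (a' + b' + d') {c'} (suc-injective (begin
    suc (a' + b' + d')                ≡⟨ cong suc (sym k≡k') ⟩
    suc (a + b)                       ≡⟨ Bump₁.on-k a b ⟨
    bump₁ a b (a + b)                 ≡⟨ agree (a + b) (≤-trans (n≤1+n _) (one-bump-fits a b c eq)) ⟩
    bump₂ a' b' c' d' (a + b)         ≡⟨ cong (bump₂ a' b' c' d') k≡k' ⟩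
    bump₂ a' b' c' d' (a' + b' + d')  ≡⟨ Bump₂.on-k a' b' c' d' ⟩
    suc (suc (c' + (a' + b' + d')))   ∎))
  where
  open ≡-Reasoning
  k≡k' : a + b ≡ a' + b' + d'
  k≡k' = same-descent (one-bump a b c eq) agree (one-bump-fits a b c eq) (Bump₁.descent a b)
           (≤-trans (n≤1+n _) (two-bumps-k+2<m a' b' c' d' e' eq')) (Bump₂.descent a' b' c' d')

shapePerm-injective : ∀ {n} (s s' : Shape n) → AgreeOn (suc n) (shapePerm s) (shapePerm s') → s ≡ s'
shapePerm-injective flat flat _ = refl
shapePerm-injective flat (one-bump a b c eq) agree =
  ⊥-elim (identity-no-descent agree (one-bump-fits a b c eq) (Bump₁.descent a b))
shapePerm-injective flat (two-bumps a b c d e eq) agree =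
  ⊥-elim (identity-no-descent agree (≤-trans (n≤1+n _) (two-bumps-k+2<m a b c d e eq)) (Bump₂.descent a b c d))
shapePerm-injective (one-bump a b c eq) flat agree =
  ⊥-elim (identity-no-descent (agree-sym agree) (one-bump-fits a b c eq) (Bump₁.descent a b))
shapePerm-injective (two-bumps a b c d e eq) flat agree =
  ⊥-elim (identity-no-descent (agree-sym agree) (≤-trans (n≤1+n _) (two-bumps-k+2<m a b c d e eq))
                              (Bump₂.descent a b c d))
shapePerm-injective (one-bump a b c eq) (two-bumps a' b' c' d' e' eq') agree =
  ⊥-elim (one-bump-≢-two-bumps eq eq' agree)
shapePerm-injective (two-bumps a b c d e eq) (one-bump a' b' c' eq') agree =
  ⊥-elim (one-bump-≢-two-bumps eq' eq (agree-sym agree))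
shapePerm-injective {n} (one-bump a b c eq) (one-bump a' b' c' eq') agree =
  one-bump-≡ a≡a' (+-cancelˡ-≡ a b b' (trans k≡k' (cong (_+ b') (sym a≡a'))))
  where
  open ≡-Reasoning
  k+1<m : suc (a + b) < suc n
  k+1<m = one-bump-fits a b c eq
  k≡k' : a + b ≡ a' + b'
  k≡k' = same-descent (one-bump a b c eq) agree k+1<m (Bump₁.descent a b)
                      (one-bump-fits a' b' c' eq') (Bump₁.descent a' b')
  a≡a' : a ≡ a'
  a≡a' = begin
    a                            ≡⟨ Bump₁.on-pivot a b ⟨
    bump₁ a b (suc (a + b))      ≡⟨ agree (suc (a + b)) k+1<m ⟩
    bump₁ a' b' (suc (a + b))    ≡⟨ cong (λ x → bump₁ a' b' (suc x)) k≡k' ⟩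
    bump₁ a' b' (suc (a' + b'))  ≡⟨ Bump₁.on-pivot a' b' ⟩
    a'                           ∎
shapePerm-injective {n} (two-bumps a b c d e eq) (two-bumps a' b' c' d' e' eq') agree =
  two-bumps-≡ a≡a' b≡b' c≡c' d≡d'
  where
  open ≡-Reasoning
  k+2<m : suc (suc (a + b + d)) < suc n
  k+2<m = two-bumps-k+2<m a b c d e eq
  k+1<m : suc (a + b + d) < suc n
  k+1<m = ≤-trans (n≤1+n _) k+2<m
  k<m : a + b + d < suc n
  k<m = ≤-trans (n≤1+n _) k+1<m
  g : ℕ → ℕ
  g = bump₂ a b c d
  g' : ℕ → ℕ
  g' = bump₂ a' b' c' d'
  k≡k' : a + b + d ≡ a' + b' + d'
  k≡k' = same-descent (two-bumps a b c d e eq) agree k+1<m (Bump₂.descent a b c d)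
           (≤-trans (n≤1+n _) (two-bumps-k+2<m a' b' c' d' e' eq')) (Bump₂.descent a' b' c' d')
  a≡a' : a ≡ a'
  a≡a' = begin
    a                          ≡⟨ Bump₂.on-pivot a b c d ⟨
    g (suc (a + b + d))        ≡⟨ agree _ k+1<m ⟩
    g' (suc (a + b + d))       ≡⟨ cong (λ x → g' (suc x)) k≡k' ⟩
    g' (suc (a' + b' + d'))    ≡⟨ Bump₂.on-pivot a' b' c' d' ⟩
    a'                         ∎
  a+b≡ : a + b ≡ a' + b'
  a+b≡ = suc-injective (begin
    suc (a + b)                    ≡⟨ Bump₂.on-lowered a b c d {0} z≤n ⟨
    g (suc (suc (a + b + d)))      ≡⟨ agree _ k+2<m ⟩
    g' (suc (suc (a + b + d)))     ≡⟨ cong (λ x → g' (suc (suc x))) k≡k' ⟩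
    g' (suc (suc (a' + b' + d')))  ≡⟨ Bump₂.on-lowered a' b' c' d' {0} z≤n ⟩
    suc (a' + b')                  ∎)
  b≡b' : b ≡ b'
  b≡b' = +-cancelˡ-≡ a b b' (trans a+b≡ (cong (_+ b') (sym a≡a')))
  d≡d' : d ≡ d'
  d≡d' = +-cancelˡ-≡ (a + b) d d' (trans k≡k' (cong (_+ d') (sym a+b≡)))
  c≡c' : c ≡ c'
  c≡c' = +-cancelʳ-≡ (a + b + d) c c' (suc-injective (suc-injective (begin
    suc (suc (c + (a + b + d)))     ≡⟨ Bump₂.on-k a b c d ⟨
    g (a + b + d)                   ≡⟨ agree _ k<m ⟩
    g' (a + b + d)                  ≡⟨ cong g' k≡k' ⟩
    g' (a' + b' + d')               ≡⟨ Bump₂.on-k a' b' c' d' ⟩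
    suc (suc (c' + (a' + b' + d'))) ≡⟨ cong (λ x → suc (suc (c' + x))) k≡k' ⟨
    suc (suc (c' + (a + b + d)))    ∎)))

-- The entries of a permutation vector as a function on ℕ, with junk value 0 outside [0, m).
entry : ∀ {m} → Vec (Fin m) m → ℕ → ℕ
entry {m} π i with i <? m
... | yes i<m = toℕ (lookup π (fromℕ< i<m))
... | no _    = 0

entry-toℕ : ∀ {m} (π : Vec (Fin m) m) (j : Fin m) → entry π (toℕ j) ≡ toℕ (lookup π j)
entry-toℕ {m} π j with toℕ j <? m
... | yes j<m = cong (λ x → toℕ (lookup π x)) (FP.fromℕ<-toℕ j j<m)
... | no j≮m  = ⊥-elim (j≮m (FP.toℕ<n j))

entry-fromℕ< : ∀ {m} (π : Vec (Fin m) m) {i} (i<m : i < m) → entry π i ≡ toℕ (lookup π (fromℕ< i<m))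
entry-fromℕ< π {i} i<m =
  subst (λ x → entry π x ≡ toℕ (lookup π (fromℕ< i<m))) (FP.toℕ-fromℕ< i<m) (entry-toℕ π (fromℕ< i<m))

entry-extensional : ∀ {m} (π π' : Vec (Fin m) m) → AgreeOn m (entry π) (entry π') → π ≡ π'
entry-extensional π π' agree =
  trans (sym (tabulate∘lookup π)) (trans (tabulate-cong (λ j → FP.toℕ-injective
    (trans (sym (entry-toℕ π j)) (trans (agree (toℕ j) (FP.toℕ<n j)) (entry-toℕ π' j))))) (tabulate∘lookup π'))

isGrassAvoid-agree : ∀ {m f g} → AgreeOn m f g → IsGrassAvoidOn m f → IsGrassAvoidOn m g
isGrassAvoid-agree {m} {f} {g} f≗g G = record
  { isPermOn     = record
    { bounded   = λ i<m → subst (_< m) (f≗g _ i<m) (bounded i<m)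
    ; injective = λ i<m j<m e → injective i<m j<m (trans (f≗g _ i<m) (trans e (sym (f≗g _ j<m))))
    }
  ; grassmannian = λ si<m sj<m di dj →
      grassmannian si<m sj<m (agree-descent f≗g si<m di) (agree-descent f≗g sj<m dj)
  ; avoids       = λ i₁<i₂ i₂<i₃ i₃<i₄ i₄<i₅ i₅<m v₃₄ v₄₁ v₁₅ v₅₂ →
      let i₄<m = <-trans i₄<i₅ i₅<m ; i₃<m = <-trans i₃<i₄ i₄<m
          i₂<m = <-trans i₂<i₃ i₃<m ; i₁<m = <-trans i₁<i₂ i₂<m
          back : ∀ {i j} → i < m → j < m → g i < g j → f i < f j
          back i<m j<m = subst₂ _<_ (sym (f≗g _ i<m)) (sym (f≗g _ j<m))
      in avoids i₁<i₂ i₂<i₃ i₃<i₄ i₄<i₅ i₅<m (back i₃<m i₄<m v₃₄) (back i₄<m i₁<m v₄₁)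
                (back i₁<m i₅<m v₁₅) (back i₅<m i₂<m v₅₂)
  }
  where open IsGrassAvoidOn G

module _ {n : ℕ} (π : Vec (Fin (suc n)) (suc n)) where
  private
    m : ℕ
    m = suc n

    entry-inject₁ : (i : Fin n) → entry π (toℕ i) ≡ toℕ (lookup π (inject₁ i))
    entry-inject₁ i = trans (cong (entry π) (sym (FP.toℕ-inject₁ i))) (entry-toℕ π (inject₁ i))

    descent⇒entry : (i : Fin n) → Descent π i → entry π (suc (toℕ i)) < entry π (toℕ i)
    descent⇒entry i = subst₂ _<_ (sym (entry-toℕ π (fsuc i))) (sym (entry-inject₁ i))

    entry⇒descent : ∀ {i} (si<m : suc i < m) → entry π (suc i) < entry π i → Descent π (fromℕ< (≤-pred si<m))
    entry⇒descent {i} si<m d =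
      subst₂ _<_ (entry-toℕ π (fsuc j)) (entry-inject₁ j)
        (subst (λ x → entry π (suc x) < entry π x) (sym (FP.toℕ-fromℕ< (≤-pred si<m))) d)
      where j = fromℕ< (≤-pred si<m)

    index-< : ∀ {i j} (i<m : i < m) (j<m : j < m) → i < j → fromℕ< i<m F.< fromℕ< j<m
    index-< i<m j<m = subst₂ _<_ (sym (FP.toℕ-fromℕ< i<m)) (sym (FP.toℕ-fromℕ< j<m))

    value-< : ∀ {i j} (i<m : i < m) (j<m : j < m) → entry π i < entry π j →
              lookup π (fromℕ< i<m) F.< lookup π (fromℕ< j<m)
    value-< i<m j<m = subst₂ _<_ (entry-fromℕ< π i<m) (entry-fromℕ< π j<m)

    entry-< : ∀ {i j : Fin m} → lookup π i F.< lookup π j → entry π (toℕ i) < entry π (toℕ j)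
    entry-< {i} {j} = subst₂ _<_ (sym (entry-toℕ π i)) (sym (entry-toℕ π j))

  isGrassAvoid⇒entry : IsGrassAvoid π → IsGrassAvoidOn m (entry π)
  isGrassAvoid⇒entry (perm , grass , av) = record
    { isPermOn     = record
      { bounded   = λ i<m → subst (_< m) (sym (entry-fromℕ< π i<m)) (FP.toℕ<n _)
      ; injective = λ i<m j<m e → trans (sym (FP.toℕ-fromℕ< i<m)) (trans (cong toℕ (perm _ _
          (FP.toℕ-injective (trans (sym (entry-fromℕ< π i<m)) (trans e (entry-fromℕ< π j<m))))))
          (FP.toℕ-fromℕ< j<m))
      }
    ; grassmannian = λ si<m sj<m di dj →
        trans (sym (FP.toℕ-fromℕ< (≤-pred si<m)))
          (trans (cong toℕ (grass _ _ (entry⇒descent si<m di) (entry⇒descent sj<m dj)))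
                 (FP.toℕ-fromℕ< (≤-pred sj<m)))
    ; avoids       = λ i₁<i₂ i₂<i₃ i₃<i₄ i₄<i₅ i₅<m v₃₄ v₄₁ v₁₅ v₅₂ →
        let i₄<m = <-trans i₄<i₅ i₅<m ; i₃<m = <-trans i₃<i₄ i₄<m
            i₂<m = <-trans i₂<i₃ i₃<m ; i₁<m = <-trans i₁<i₂ i₂<m
        in av (_ , _ , _ , _ , _ ,
               (index-< i₁<m i₂<m i₁<i₂ , index-< i₂<m i₃<m i₂<i₃ ,
                index-< i₃<m i₄<m i₃<i₄ , index-< i₄<m i₅<m i₄<i₅) ,
               (value-< i₃<m i₄<m v₃₄ , value-< i₄<m i₁<m v₄₁ ,
                value-< i₁<m i₅<m v₁₅ , value-< i₅<m i₂<m v₅₂))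
    }

  entry⇒isGrassAvoid : IsGrassAvoidOn m (entry π) → IsGrassAvoid π
  entry⇒isGrassAvoid G = perm , grass , av
    where
    open IsGrassAvoidOn G
    perm : IsPerm π
    perm i j e = FP.toℕ-injective (injective (FP.toℕ<n i) (FP.toℕ<n j)
                   (trans (entry-toℕ π i) (trans (cong toℕ e) (sym (entry-toℕ π j)))))
    grass : IsGrassmannian π
    grass i j di dj = FP.toℕ-injective
      (grassmannian (s≤s (FP.toℕ<n i)) (s≤s (FP.toℕ<n j)) (descent⇒entry i di) (descent⇒entry j dj))
    av : Avoids35124 π
    av (j₁ , j₂ , j₃ , j₄ , j₅ , (j₁<j₂ , j₂<j₃ , j₃<j₄ , j₄<j₅) , (v₃₄ , v₄₁ , v₁₅ , v₅₂)) =
      avoids j₁<j₂ j₂<j₃ j₃<j₄ j₄<j₅ (FP.toℕ<n j₅) (entry-< v₃₄) (entry-< v₄₁) (entry-< v₁₅) (entry-< v₅₂)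

shapeIndex : ∀ {n} → Shape n → Fin (suc n) → Fin (suc n)
shapeIndex s j = fromℕ< (IsGrassAvoidOn.bounded (shapePerm-isGrassAvoid s) (FP.toℕ<n j))

shapeVec : ∀ {n} → Shape n → Vec (Fin (suc n)) (suc n)
shapeVec s = tabulate (shapeIndex s)

entry-shapeVec : ∀ {n} (s : Shape n) → AgreeOn (suc n) (entry (shapeVec s)) (shapePerm s)
entry-shapeVec s i i<m = begin
  entry (shapeVec s) i                   ≡⟨ entry-fromℕ< (shapeVec s) i<m ⟩
  toℕ (lookup (shapeVec s) (fromℕ< i<m)) ≡⟨ cong toℕ (lookup∘tabulate (shapeIndex s) (fromℕ< i<m)) ⟩
  toℕ (fromℕ< _)                         ≡⟨ FP.toℕ-fromℕ< _ ⟩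
  shapePerm s (toℕ (fromℕ< i<m))         ≡⟨ cong (shapePerm s) (FP.toℕ-fromℕ< i<m) ⟩
  shapePerm s i                          ∎
  where open ≡-Reasoning

shapes↔G35124 : ∀ n → Shape n ↔ G35124 n
shapes↔G35124 n = ↔-subset isGrassAvoid? shapeVec shapeVec-isGrassAvoid decode injective
  where
  shapeVec-isGrassAvoid : ∀ s → IsGrassAvoid (shapeVec s)
  shapeVec-isGrassAvoid s =
    entry⇒isGrassAvoid (shapeVec s) (isGrassAvoid-agree (agree-sym (entry-shapeVec s)) (shapePerm-isGrassAvoid s))
  decode : ∀ π → IsGrassAvoid π → Σ (Shape n) λ s → shapeVec s ≡ π
  decode π G with s , π≗s ← grassAvoid⇒shape (isGrassAvoid⇒entry π G) =
    s , entry-extensional (shapeVec s) π (λ i i<m → trans (entry-shapeVec s i i<m) (sym (π≗s i i<m)))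
  injective : ∀ s s' → shapeVec s ≡ shapeVec s' → s ≡ s'
  injective s s' e = shapePerm-injective s s'
    (λ i i<m → trans (sym (entry-shapeVec s i i<m)) (trans (cong (λ π → entry π i) e) (entry-shapeVec s' i i<m)))

-- Schröder words

hs : ℕ → List Letter
hs a = replicate a H

oneBumpWord : ℕ → ℕ → ℕ → List Letter
oneBumpWord a b c = hs a ++ U ∷ hs b ++ D ∷ hs c

twoBumpsWord : ℕ → ℕ → ℕ → ℕ → ℕ → List Letter
twoBumpsWord a b c d e = hs a ++ U ∷ hs b ++ D ∷ hs c ++ U ∷ hs d ++ D ∷ hs e

shapeWord : ∀ {n} → Shape n → List Letter
shapeWord {n} flat                = hs n
shapeWord (one-bump a b c _)      = oneBumpWord a b c
shapeWord (two-bumps a b c d e _) = twoBumpsWord a b c d e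

-- The prefix conditions of IsSchroder and IsRestricted, read letter by letter.
HeightsIn : (ℤ → Set) → ℤ → List Letter → Set
HeightsIn Q h []      = Q h
HeightsIn Q h (x ∷ w) = Q h × HeightsIn Q (h ℤ.+ valL x) w

NonNegative : ℤ → Set
NonNegative z = 0ℤ ℤ.≤ z

ZeroOrOne : ℤ → Set
ZeroOrOne z = z ≡ 0ℤ ⊎ z ≡ 1ℤ

heightsIn-head : ∀ {Q h} w → HeightsIn Q h w → Q h
heightsIn-head []      q       = q
heightsIn-head (x ∷ w) (q , _) = q

prefixes⇒heightsIn : ∀ (Q : ℤ → Set) h w → All (λ u → Q (h ℤ.+ val u)) (inits w) → HeightsIn Q h w
prefixes⇒heightsIn Q h []      (q ∷ [])   = subst Q (ℤP.+-identityʳ h) q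
prefixes⇒heightsIn Q h (x ∷ w) (q ∷ rest) =
  subst Q (ℤP.+-identityʳ h) q ,
  prefixes⇒heightsIn Q (h ℤ.+ valL x) w
    (All.map (λ {u} → subst Q (sym (ℤP.+-assoc h (valL x) (val u)))) (AllP.map⁻ {f = x ∷_} rest))

heightsIn⇒prefixes : ∀ (Q : ℤ → Set) h w → HeightsIn Q h w → All (λ u → Q (h ℤ.+ val u)) (inits w)
heightsIn⇒prefixes Q h []      q        = subst Q (sym (ℤP.+-identityʳ h)) q ∷ []
heightsIn⇒prefixes Q h (x ∷ w) (q , qs) =
  subst Q (sym (ℤP.+-identityʳ h)) q ∷
  AllP.map⁺ {f = x ∷_} (All.map (λ {u} → subst Q (ℤP.+-assoc h (valL x) (val u)))
                                (heightsIn⇒prefixes Q (h ℤ.+ valL x) w qs))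

prefixes⇒heightsIn₀ : ∀ (Q : ℤ → Set) w → All (λ u → Q (val u)) (inits w) → HeightsIn Q 0ℤ w
prefixes⇒heightsIn₀ Q w qs =
  prefixes⇒heightsIn Q 0ℤ w (All.map (λ {u} → subst Q (sym (ℤP.+-identityˡ (val u)))) qs)

heightsIn⇒prefixes₀ : ∀ (Q : ℤ → Set) w → HeightsIn Q 0ℤ w → All (λ u → Q (val u)) (inits w)
heightsIn⇒prefixes₀ Q w qs = All.map (λ {u} → subst Q (ℤP.+-identityˡ (val u))) (heightsIn⇒prefixes Q 0ℤ w qs)

heightsIn-hs++ : ∀ {Q : ℤ → Set} a h w → Q h → HeightsIn Q h w → HeightsIn Q h (hs a ++ w)
heightsIn-hs++         zero    h w q qs = qs
heightsIn-hs++ {Q} (suc a) h w q qs =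
  q , subst (λ z → HeightsIn Q z (hs a ++ w)) (sym (ℤP.+-identityʳ h)) (heightsIn-hs++ a h w q qs)

heightsIn-hs : ∀ {Q : ℤ → Set} a h → Q h → HeightsIn Q h (hs a)
heightsIn-hs         zero    h q = q
heightsIn-hs {Q} (suc a) h q = q , subst (λ z → HeightsIn Q z (hs a)) (sym (ℤP.+-identityʳ h)) (heightsIn-hs a h q)

shapeWord-heightsIn : ∀ {n} {Q : ℤ → Set} → Q 0ℤ → Q 1ℤ → (s : Shape n) → HeightsIn Q 0ℤ (shapeWord s)
shapeWord-heightsIn {n} q₀ q₁ flat = heightsIn-hs n 0ℤ q₀
shapeWord-heightsIn q₀ q₁ (one-bump a b c _) =
  heightsIn-hs++ a 0ℤ _ q₀ (q₀ , heightsIn-hs++ b 1ℤ _ q₁ (q₁ , heightsIn-hs c 0ℤ q₀))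
shapeWord-heightsIn q₀ q₁ (two-bumps a b c d e _) =
  heightsIn-hs++ a 0ℤ _ q₀ (q₀ , heightsIn-hs++ b 1ℤ _ q₁ (q₁ ,
  heightsIn-hs++ c 0ℤ _ q₀ (q₀ , heightsIn-hs++ d 1ℤ _ q₁ (q₁ , heightsIn-hs e 0ℤ q₀))))

val-hs++ : ∀ a w → val (hs a ++ w) ≡ val w
val-hs++ zero    w = refl
val-hs++ (suc a) w = trans (ℤP.+-identityˡ _) (val-hs++ a w)

val-hs : ∀ a → val (hs a) ≡ 0ℤ
val-hs zero    = refl
val-hs (suc a) = trans (ℤP.+-identityˡ _) (val-hs a)

val-shapeWord : ∀ {n} (s : Shape n) → val (shapeWord s) ≡ 0ℤ
val-shapeWord {n} flat = val-hs n
val-shapeWord (one-bump a b c _) =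
  trans (val-hs++ a _) (cong (λ z → 1ℤ ℤ.+ z) (trans (val-hs++ b _) (cong (λ z → ℤ.- 1ℤ ℤ.+ z) (val-hs c))))
val-shapeWord (two-bumps a b c d e _) =
  trans (val-hs++ a _) (cong (λ z → 1ℤ ℤ.+ z) (trans (val-hs++ b _) (cong (λ z → ℤ.- 1ℤ ℤ.+ z)
  (trans (val-hs++ c _) (cong (λ z → 1ℤ ℤ.+ z) (trans (val-hs++ d _) (cong (λ z → ℤ.- 1ℤ ℤ.+ z) (val-hs e))))))))

occU-hs++ : ∀ a w → occ U (hs a ++ w) ≡ occ U w
occU-hs++ zero    w = refl
occU-hs++ (suc a) w = occU-hs++ a w

occD-hs++ : ∀ a w → occ D (hs a ++ w) ≡ occ D w
occD-hs++ zero    w = refl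
occD-hs++ (suc a) w = occD-hs++ a w

occH-hs++ : ∀ a w → occ H (hs a ++ w) ≡ a + occ H w
occH-hs++ zero    w = refl
occH-hs++ (suc a) w = cong suc (occH-hs++ a w)

occU-hs : ∀ a → occ U (hs a) ≡ 0
occU-hs zero    = refl
occU-hs (suc a) = occU-hs a

occD-hs : ∀ a → occ D (hs a) ≡ 0
occD-hs zero    = refl
occD-hs (suc a) = occD-hs a

occH-hs : ∀ a → occ H (hs a) ≡ a
occH-hs zero    = refl
occH-hs (suc a) = cong suc (occH-hs a)

occU-oneBump : ∀ a b c → occ U (oneBumpWord a b c) ≡ 1
occU-oneBump a b c = trans (occU-hs++ a _) (cong suc (trans (occU-hs++ b _) (occU-hs c)))

occD-oneBump : ∀ a b c → occ D (oneBumpWord a b c) ≡ 1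
occD-oneBump a b c = trans (occD-hs++ a _) (trans (occD-hs++ b _) (cong suc (occD-hs c)))

occH-oneBump : ∀ a b c → occ H (oneBumpWord a b c) ≡ a + (b + c)
occH-oneBump a b c = trans (occH-hs++ a _) (cong (a +_) (trans (occH-hs++ b _) (cong (b +_) (occH-hs c))))

occU-twoBumps : ∀ a b c d e → occ U (twoBumpsWord a b c d e) ≡ 2
occU-twoBumps a b c d e =
  trans (occU-hs++ a _) (cong suc (trans (occU-hs++ b _) (trans (occU-hs++ c _)
    (cong suc (trans (occU-hs++ d _) (occU-hs e))))))

occD-twoBumps : ∀ a b c d e → occ D (twoBumpsWord a b c d e) ≡ 2
occD-twoBumps a b c d e =
  trans (occD-hs++ a _) (trans (occD-hs++ b _) (cong suc (trans (occD-hs++ c _)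
    (trans (occD-hs++ d _) (cong suc (occD-hs e))))))

occH-twoBumps : ∀ a b c d e → occ H (twoBumpsWord a b c d e) ≡ a + (b + (c + (d + e)))
occH-twoBumps a b c d e =
  trans (occH-hs++ a _) (cong (a +_) (trans (occH-hs++ b _) (cong (b +_) (trans (occH-hs++ c _)
    (cong (c +_) (trans (occH-hs++ d _) (cong (d +_) (occH-hs e))))))))

weight-one-bump : ∀ a b c → 1 + 1 + 2 * (a + (b + c)) ≡ 2 * (a + b + c + 1)
weight-one-bump = solve-∀

weight-two-bumps : ∀ a b c d e → 2 + 2 + 2 * (a + (b + (c + (d + e)))) ≡ 2 * (a + b + c + d + e + 2)
weight-two-bumps = solve-∀

semilength-shapeWord : ∀ {n} (s : Shape n) →
                       occ U (shapeWord s) + occ D (shapeWord s) + 2 * occ H (shapeWord s) ≡ 2 * n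
semilength-shapeWord {n} flat rewrite occU-hs n | occD-hs n | occH-hs n = refl
semilength-shapeWord (one-bump a b c eq)
  rewrite occU-oneBump a b c | occD-oneBump a b c | occH-oneBump a b c =
  trans (weight-one-bump a b c) (cong (2 *_) eq)
semilength-shapeWord (two-bumps a b c d e eq)
  rewrite occU-twoBumps a b c d e | occD-twoBumps a b c d e | occH-twoBumps a b c d e =
  trans (weight-two-bumps a b c d e) (cong (2 *_) eq)

occU-shapeWord-≤ : ∀ {n} (s : Shape n) → occ U (shapeWord s) ≤ 2
occU-shapeWord-≤ {n} flat rewrite occU-hs n = z≤n
occU-shapeWord-≤ (one-bump a b c _) rewrite occU-oneBump a b c = s≤s z≤n
occU-shapeWord-≤ (two-bumps a b c d e _) rewrite occU-twoBumps a b c d e = s≤s (s≤s z≤n)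

shapeWord-isSchrUUDD : ∀ {n} (s : Shape n) → IsSchrUUDD n (shapeWord s)
shapeWord-isSchrUUDD s =
  (val-shapeWord s ,
   heightsIn⇒prefixes₀ NonNegative _ (shapeWord-heightsIn (+≤+ z≤n) (+≤+ z≤n) s) ,
   semilength-shapeWord s) ,
  (heightsIn⇒prefixes₀ ZeroOrOne _ (shapeWord-heightsIn (inj₁ refl) (inj₂ refl) s) ,
   occU-shapeWord-≤ s)

transpose : ∀ z x y → z ℤ.+ x ≡ y → x ≡ (ℤ.- z) ℤ.+ y
transpose z x y e = trans (sym (ℤP.+-identityˡ x)) (trans (cong (ℤ._+ x) (sym (ℤP.+-inverseˡ z)))
                    (trans (ℤP.+-assoc (ℤ.- z) z x) (cong (λ t → (ℤ.- z) ℤ.+ t) e)))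

val-H∷ : ∀ {w t} → val (H ∷ w) ≡ t → val w ≡ t
val-H∷ {w} e = trans (sym (ℤP.+-identityˡ (val w))) e

-- Parsing a word whose heights stay in {0, 1}: from height 0 the next letter is H or U, from
-- height 1 it is H or D, so each function below handles one height and one bound on the U's.
parse-flat : ∀ w → HeightsIn ZeroOrOne 0ℤ w → occ U w ≤ 0 → Σ ℕ λ e → w ≡ hs e
parse-flat [] _ _ = 0 , refl
parse-flat (H ∷ w) (_ , wk) o with parse-flat w wk o
... | e , eq = suc e , cong (H ∷_) eq
parse-flat (U ∷ w) _ ()
parse-flat (D ∷ w) (_ , wk) o with heightsIn-head w wk
... | inj₁ ()
... | inj₂ ()

parse-descent : ∀ w → HeightsIn ZeroOrOne 1ℤ w → val w ≡ ℤ.- 1ℤ → occ U w ≤ 0 →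
                Σ ℕ λ d → Σ ℕ λ e → w ≡ hs d ++ D ∷ hs e
parse-descent [] _ () _
parse-descent (H ∷ w) (_ , wk) v o with parse-descent w wk (val-H∷ {w} v) o
... | d , e , eq = suc d , e , cong (H ∷_) eq
parse-descent (U ∷ w) _ _ ()
parse-descent (D ∷ w) (_ , wk) v o with parse-flat w wk o
... | e , eq = 0 , e , cong (D ∷_) eq

FlatOrOneBump : List Letter → Set
FlatOrOneBump w = (Σ ℕ λ c → w ≡ hs c) ⊎
                  (Σ ℕ λ c → Σ ℕ λ d → Σ ℕ λ e → w ≡ hs c ++ U ∷ hs d ++ D ∷ hs e)

parse-≤1-bump : ∀ w → HeightsIn ZeroOrOne 0ℤ w → val w ≡ 0ℤ → occ U w ≤ 1 → FlatOrOneBump w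
parse-≤1-bump [] _ _ _ = inj₁ (0 , refl)
parse-≤1-bump (H ∷ w) (_ , wk) v o with parse-≤1-bump w wk (val-H∷ {w} v) o
... | inj₁ (c , eq) = inj₁ (suc c , cong (H ∷_) eq)
... | inj₂ (c , d , e , eq) = inj₂ (suc c , d , e , cong (H ∷_) eq)
parse-≤1-bump (D ∷ w) (_ , wk) v o with heightsIn-head w wk
... | inj₁ ()
... | inj₂ ()
parse-≤1-bump (U ∷ w) (_ , wk) v (s≤s o) with parse-descent w wk (transpose 1ℤ (val w) 0ℤ v) o
... | d , e , eq = inj₂ (0 , d , e , cong (U ∷_) eq)

DescentThenFlatOrOneBump : List Letter → Set
DescentThenFlatOrOneBump w =
  (Σ ℕ λ b → Σ ℕ λ c → w ≡ hs b ++ D ∷ hs c) ⊎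
  (Σ ℕ λ b → Σ ℕ λ c → Σ ℕ λ d → Σ ℕ λ e → w ≡ hs b ++ D ∷ hs c ++ U ∷ hs d ++ D ∷ hs e)

parse-descent-≤1-bump : ∀ w → HeightsIn ZeroOrOne 1ℤ w → val w ≡ ℤ.- 1ℤ → occ U w ≤ 1 →
                        DescentThenFlatOrOneBump w
parse-descent-≤1-bump [] _ () _
parse-descent-≤1-bump (H ∷ w) (_ , wk) v o with parse-descent-≤1-bump w wk (val-H∷ {w} v) o
... | inj₁ (b , c , eq) = inj₁ (suc b , c , cong (H ∷_) eq)
... | inj₂ (b , c , d , e , eq) = inj₂ (suc b , c , d , e , cong (H ∷_) eq)
parse-descent-≤1-bump (U ∷ w) (_ , wk) v o with heightsIn-head w wk
... | inj₁ ()
... | inj₂ ()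
parse-descent-≤1-bump (D ∷ w) (_ , wk) v o
  with parse-≤1-bump w wk (transpose (ℤ.- 1ℤ) (val w) (ℤ.- 1ℤ) v) o
... | inj₁ (c , eq) = inj₁ (0 , c , cong (D ∷_) eq)
... | inj₂ (c , d , e , eq) = inj₂ (0 , c , d , e , cong (D ∷_) eq)

AtMostTwoBumps : List Letter → Set
AtMostTwoBumps w =
  (Σ ℕ λ a → w ≡ hs a) ⊎
  (Σ ℕ λ a → Σ ℕ λ b → Σ ℕ λ c → w ≡ oneBumpWord a b c) ⊎
  (Σ ℕ λ a → Σ ℕ λ b → Σ ℕ λ c → Σ ℕ λ d → Σ ℕ λ e → w ≡ twoBumpsWord a b c d e)

parse-≤2-bumps : ∀ w → HeightsIn ZeroOrOne 0ℤ w → val w ≡ 0ℤ → occ U w ≤ 2 → AtMostTwoBumps w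
parse-≤2-bumps [] _ _ _ = inj₁ (0 , refl)
parse-≤2-bumps (H ∷ w) (_ , wk) v o with parse-≤2-bumps w wk (val-H∷ {w} v) o
... | inj₁ (a , eq) = inj₁ (suc a , cong (H ∷_) eq)
... | inj₂ (inj₁ (a , b , c , eq)) = inj₂ (inj₁ (suc a , b , c , cong (H ∷_) eq))
... | inj₂ (inj₂ (a , b , c , d , e , eq)) = inj₂ (inj₂ (suc a , b , c , d , e , cong (H ∷_) eq))
parse-≤2-bumps (D ∷ w) (_ , wk) v o with heightsIn-head w wk
... | inj₁ ()
... | inj₂ ()
parse-≤2-bumps (U ∷ w) (_ , wk) v (s≤s o)
  with parse-descent-≤1-bump w wk (transpose 1ℤ (val w) 0ℤ v) o
... | inj₁ (b , c , eq) = inj₂ (inj₁ (0 , b , c , cong (U ∷_) eq))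
... | inj₂ (b , c , d , e , eq) = inj₂ (inj₂ (0 , b , c , d , e , cong (U ∷_) eq))

schrUUDD⇒shape : ∀ n w → IsSchrUUDD n w → Σ (Shape n) λ s → shapeWord s ≡ w
schrUUDD⇒shape n w ((v , _ , size) , (heights , ≤2)) =
  sized (parse-≤2-bumps w (prefixes⇒heightsIn₀ ZeroOrOne w heights) v ≤2) size
  where
  sized : AtMostTwoBumps w → occ U w + occ D w + 2 * occ H w ≡ 2 * n → Σ (Shape n) λ s → shapeWord s ≡ w
  sized (inj₁ (a , refl)) size rewrite occU-hs a | occD-hs a | occH-hs a =
    flat , cong hs (sym (*-cancelˡ-≡ a n 2 size))
  sized (inj₂ (inj₁ (a , b , c , refl))) size
    rewrite occU-oneBump a b c | occD-oneBump a b c | occH-oneBump a b c =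
    one-bump a b c (*-cancelˡ-≡ _ n 2 (trans (sym (weight-one-bump a b c)) size)) , refl
  sized (inj₂ (inj₂ (a , b , c , d , e , refl))) size
    rewrite occU-twoBumps a b c d e | occD-twoBumps a b c d e | occH-twoBumps a b c d e =
    two-bumps a b c d e (*-cancelˡ-≡ _ n 2 (trans (sym (weight-two-bumps a b c d e)) size)) , refl

hs++-injective : ∀ a a' {x x' : Letter} {r r'} → x ≢ H → x' ≢ H →
                 hs a ++ x ∷ r ≡ hs a' ++ x' ∷ r' → a ≡ a' × r ≡ r'
hs++-injective zero    zero     x≢H x'≢H e = refl , proj₂ (∷-injective e)
hs++-injective zero    (suc a') x≢H x'≢H e = ⊥-elim (x≢H (proj₁ (∷-injective e)))
hs++-injective (suc a) zero     x≢H x'≢H e = ⊥-elim (x'≢H (sym (proj₁ (∷-injective e))))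
hs++-injective (suc a) (suc a') {x} {x'} {r} {r'} x≢H x'≢H e =
  map₁ (cong suc) (hs++-injective a a' {x} {x'} {r} {r'} x≢H x'≢H (proj₂ (∷-injective e)))

U≢H : U ≢ H
U≢H ()

D≢H : D ≢ H
D≢H ()

bumps : ∀ {n} → Shape n → ℕ
bumps flat = 0
bumps (one-bump _ _ _ _) = 1
bumps (two-bumps _ _ _ _ _ _) = 2

occU-shapeWord : ∀ {n} (s : Shape n) → occ U (shapeWord s) ≡ bumps s
occU-shapeWord {n} flat = occU-hs n
occU-shapeWord (one-bump a b c _) = occU-oneBump a b c
occU-shapeWord (two-bumps a b c d e _) = occU-twoBumps a b c d e

bumps-shapeWord : ∀ {n} (s s' : Shape n) → shapeWord s ≡ shapeWord s' → bumps s ≡ bumps s'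
bumps-shapeWord s s' e = trans (sym (occU-shapeWord s)) (trans (cong (occ U) e) (occU-shapeWord s'))

shapeWord-injective : ∀ {n} (s s' : Shape n) → shapeWord s ≡ shapeWord s' → s ≡ s'
shapeWord-injective flat flat e = refl
shapeWord-injective (one-bump a b c _) (one-bump a' b' c' _) w≡w'
  with a≡a' , rest ← hs++-injective a a' U≢H U≢H w≡w'
  with b≡b' , _    ← hs++-injective b b' D≢H D≢H rest
  = one-bump-≡ a≡a' b≡b'
shapeWord-injective (two-bumps a b c d e _) (two-bumps a' b' c' d' e' _) w≡w'
  with a≡a' , rest₁ ← hs++-injective a a' U≢H U≢H w≡w'
  with b≡b' , rest₂ ← hs++-injective b b' D≢H D≢H rest₁
  with c≡c' , rest₃ ← hs++-injective c c' U≢H U≢H rest₂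
  with d≡d' , _     ← hs++-injective d d' D≢H D≢H rest₃
  = two-bumps-≡ a≡a' b≡b' c≡c' d≡d'
shapeWord-injective s@flat s'@(one-bump _ _ _ _) e = ⊥-elim (0≢1+n (bumps-shapeWord s s' e))
shapeWord-injective s@flat s'@(two-bumps _ _ _ _ _ _) e = ⊥-elim (0≢1+n (bumps-shapeWord s s' e))
shapeWord-injective s@(one-bump _ _ _ _) s'@flat e = ⊥-elim (1+n≢0 (bumps-shapeWord s s' e))
shapeWord-injective s@(one-bump _ _ _ _) s'@(two-bumps _ _ _ _ _ _) e =
  ⊥-elim (0≢1+n (suc-injective (bumps-shapeWord s s' e)))
shapeWord-injective s@(two-bumps _ _ _ _ _ _) s'@flat e = ⊥-elim (1+n≢0 (bumps-shapeWord s s' e))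
shapeWord-injective s@(two-bumps _ _ _ _ _ _) s'@(one-bump _ _ _ _) e =
  ⊥-elim (1+n≢0 (suc-injective (bumps-shapeWord s s' e)))

shapes↔SchrUUDD : ∀ n → Shape n ↔ SchrUUDD n
shapes↔SchrUUDD n =
  ↔-subset (isSchrUUDD? n) shapeWord shapeWord-isSchrUUDD (schrUUDD⇒shape n) shapeWord-injective

mainTheorem10 : (n : ℕ) → 1 ≤ n → SchrUUDD n ↔ G35124 n
mainTheorem10 n _ = ↔-trans (↔-sym (shapes↔SchrUUDD n)) (shapes↔G35124 n)
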